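{- For $m\ge1$, $n\ge0$, $k\ge0$, $$S^o_{\mathrm{CR}}[m,n,k]=\sum_{\omega\in S^o_{\mathrm{CR}}([n^m],k)}q^{\operatorname{inv}\omega},$$ where $S^o_{\mathrm{CR}}[m,n,k]=[km]!_m\,S[m,n,k]$.
   Context: $[j]=1+q+\dots+q^{j-1}$; $[km]!_m=[m][2m]\cdots[km]$ (empty product $1$ for $k=0$). Let $\zeta_m=e^{2\pi i/m}$, $i^c=\zeta_m^c\mathbf e_i$ for $i\in[n]$ (colors mod $m$), $[n^m]=\{0\}\cup\{i^c:i\in[n],0\le c<m\}$, $zS=\{zs:s\in S\}$. A colored set partition of type $(m,n)$ is a set partition of $[n^m]$ into blocks $S_0,\dots,S_{km}$ with (i) $0\in S_0$ and if some $i^c\in S_0$ then all $i^d\in S_0$; (ii) for each $0\le l<k$, $S_{lm+1},\dots,S_{(l+1)m}$ are distinct and of the form $S,\zeta_mS,\dots,\zeta_m^{m-1}S$. For nonempty $S$, $\operatorname{minb}S=0$ if $0\in S$, else the least base in $S$. Standard form: blocks labeled so that (ii) holds, $s_i=\operatorname{minb}S_i$ satisfy $0=s_0<s_m<\dots<s_{km}$, and $s_j^{\,r}\in S_j$ for $j\in[km]$ with $r=j\bmod m$. An inversion of a partition in standard form is a pair $(i^0,S_l)$ with $i^0\in S_j$, $j<l$, $i\ge s_l$. $S[m,n,k]=\sum q^{\operatorname{inv}\sigma}$ over type $(m,n)$ colored set partitions with $km+1$ blocks. A CR-ordered set partition is a sequence $\omega=(S_0/S_1/\dots/S_{km})$ whose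 blocks form a type $(m,n)$ colored set partition with zero block $S_0$ (no ordering inside $S_0$) and such that $S_{i+1}=\zeta_mS_i$ for all $i\in[km-1]$ not divisible by $m$; $S^o_{\mathrm{CR}}([n^m],k)$ is the set of these with $km+1$ blocks. An inversion of $\omega$ is a pair $(i^0,S_l)$ with $i^0\in S_j$, $j<l$, and $i\ge\operatorname{minb}S_l$. -}

module Defs where

open import Data.Nat using (ℕ; zero; suc; _+_; _*_; _^_; _≤_; _<_; _<ᵇ_; _≤ᵇ_; _≡ᵇ_; NonZero)
open import Data.Nat.DivMod using (_%_)
open import Data.Nat.Divisibility using (_∣_)
open import Data.Bool using (Bool; true; false; if_then_else_; _∧_)
open import Data.Fin using (Fin; toℕ)
open import Data.Vec using (Vec; lookup)
open import Data.List using (List; allFin; upTo; map; foldr; concatMap)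
open import Data.Nat.ListAction using (sum; product)
open import Data.Bool.ListAction using (any)
open import Data.Product using (Σ; ∃; ∃-syntax; _×_)
open import Relation.Nullary using (¬_)
open import Relation.Binary.PropositionalEquality using (_≡_)
open import Function.Bundles using (_⇔_)

qint : ℕ → ℕ → ℕ
qint q j = sum (map (q ^_) (upTo j))

-- [km]!_m = [m][2m]...[km]  (empty product 1 for k = 0)
qfactm : ℕ → ℕ → ℕ → ℕ
qfactm q m k = product (map (λ t → qint q (suc t * m)) (upTo k))

-- A labelling of [n^m]∖{0} by block indices 0..km.  The element i^c
-- (i : Fin n stands for the base toℕ i + 1, c : Fin m the colour) lies in
-- block S_(lab f i c); the element 0 always lies in S_0.
Label : ℕ → ℕ → ℕ → Set
Label m n k = Vec (Vec (Fin (suc (k * m))) m) n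

module _ (m n k : ℕ) where

  lab : Label m n k → Fin n → Fin m → ℕ
  lab f i c = toℕ (lookup (lookup f i) c)

  -- minb S_j for j ≥ 1 (0 ∉ S_j): the least base occurring in S_j, encoded
  -- shifted by one (base b is returned as b - 1); returns n if S_j = ∅.
  minb : Label m n k → ℕ → ℕ
  minb f j = foldr (λ i acc → if any (λ c → lab f i c ≡ᵇ j) (allFin m) then toℕ i else acc)
                   n (allFin n)

  module _ .{{_ : NonZero m}} where

    -- S_j' = ζ_m^t S_j  (for j, j' ≥ 1, so 0 lies in neither)
    RotBlock : Label m n k → ℕ → ℕ → ℕ → Set
    RotBlock f t j j' = ∀ (i : Fin n) (c c' : Fin m) → toℕ c' ≡ (toℕ c + t) % m →
                        (lab f i c ≡ j ⇔ lab f i c' ≡ j')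

    record IsColoredPartition (f : Label m n k) : Set where
      field
        nonempty  : ∀ j → 1 ≤ j → j ≤ k * m → ∃[ i ] ∃[ c ] lab f i c ≡ j
        zeroBlock : ∀ (i : Fin n) (c d : Fin m) → lab f i c ≡ 0 → lab f i d ≡ 0
        orbits    : ∀ l → l < k → ∀ u → u < m →
                    ∃[ t ] (t < m × RotBlock f t (l * m + 1) (l * m + 1 + u))

    record IsStandard (f : Label m n k) : Set where
      field
        partition  : IsColoredPartition f
        increasing : ∀ l → 1 ≤ l → l < k → minb f (l * m) < minb f (suc l * m)
        colours    : ∀ j → 1 ≤ j → j ≤ k * m → ∀ (i : Fin n) (c : Fin m) →
                     toℕ i ≡ minb f j → toℕ c ≡ j % m → lab f i c ≡ j

    record IsCROrdered (f : Label m n k) : Set where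
      field
        partition : IsColoredPartition f
        cr        : ∀ j → 1 ≤ j → j < k * m → ¬ (m ∣ j) → RotBlock f 1 j (suc j)

  inv : Label m n k → ℕ
  inv f = sum (concatMap (λ i → concatMap (λ c → map (λ l →
            if (toℕ c ≡ᵇ 0) ∧ (lab f i c <ᵇ l) ∧ (minb f l ≤ᵇ toℕ i) then 1 else 0)
            (map suc (upTo (k * m)))) (allFin m)) (allFin n))

  genfun : ℕ → List (Label m n k) → ℕ
  genfun q L = sum (map (λ f → q ^ inv f) L)

{-# OPTIONS --safe #-}
-- A labelling satisfying the rotation conditions is determined by one code per base: the base
-- either lies in S_0 or lies in an orbit p with a rotation offset o < m. Inversions become a
-- statistic of the code word, and appending a base multiplies the weight by q to the number of
-- occupied blocks beyond its own. Splitting on the last base, standard partitions with j orbits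
-- satisfy S[m,n+1,j] = [jm+1] S[m,n,j] + S[m,n,j-1]. For CR-ordered partitions occupying j orbits,
-- the last base sits in one of the jm blocks of these orbits, joining or opening its orbit, and the
-- weights of these positions sum to [jm]; so their generating function satisfies
-- G_j(n+1) = [jm+1] G_j(n) + [jm] G_(j-1)(n), which is solved by [jm]!_m S[m,n,j].
module Submission where

open import Defs
open import Data.Bool using (Bool; true; false; if_then_else_; _∧_; _∨_; not)
open import Data.Bool.ListAction using (any)
open import Data.Bool.Properties using (T?; T-≡; ⇔→≡; ¬-not; ∨-identityʳ; ∨-zeroʳ; ∧-identityʳ; ∧-zeroʳ)
open import Data.Empty using (⊥; ⊥-elim)
open import Data.Fin as Fin using (Fin; toℕ; fromℕ<)
import Data.Fin.Properties as Fin
open import Data.List as List using (List; []; _∷_; map; applyUpTo; upTo; allFin; tabulate; filter; foldr; concatMap; cartesianProductWith)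
open import Data.List.Membership.Propositional using (_∈_)
open import Data.List.Membership.Propositional.Properties
  using (∈-allFin; ∈-map⁺; ∈-map⁻; ∈-filter⁺; ∈-filter⁻; ∈-cartesianProductWith⁺; ∈-cartesianProduct⁺)
open import Data.List.Membership.Propositional.Properties.WithK using (unique∧set⇒bag)
open import Data.List.Properties using (map-applyUpTo; map-++; map-∘; map-cong; upTo-∷ʳ; foldr-cong)
open import Data.List.Relation.Binary.BagAndSetEquality using (∼bag⇒↭)
open import Data.List.Relation.Binary.Permutation.Propositional using (_↭_)
import Data.List.Relation.Binary.Permutation.Propositional.Properties as Perm
open import Data.List.Relation.Unary.All using (All; []; _∷_)
open import Data.List.Relation.Unary.AllPairs using ([]; _∷_)
open import Data.List.Relation.Unary.Any using (here; there)
open import Data.List.Relation.Unary.Unique.Propositional using (Unique)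
import Data.List.Relation.Unary.Unique.Propositional.Properties as Unique
open import Data.Maybe using (Maybe; just; nothing)
open import Data.Nat
open import Data.Nat.DivMod
open import Data.Nat.Divisibility using (_∣_; n∣m⇒m%n≡0; m%n≡0⇒n∣m)
open import Data.Nat.ListAction using (sum; product)
open import Data.Nat.ListAction.Properties using (sum-++; product-++; sum-↭)
open import Data.Nat.Properties
open import Data.Nat.Solver using (module +-*-Solver)
open import Data.Product using (Σ-syntax; ∃-syntax; _×_; _,_; proj₁; proj₂)
open import Data.Sum using (_⊎_; inj₁; inj₂)
open import Data.Vec as Vec using (Vec; lookup)
import Data.Vec.Properties as Vec
open import Function using (_∘_; id)
open import Function.Bundles using (_⇔_; mk⇔; Equivalence)
open import Relation.Binary.PropositionalEquality
open import Relation.Nullary using (¬_; yes; no)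
open import Relation.Nullary.Reflects using (Reflects; ofʸ; ofⁿ; fromEquivalence)

open +-*-Solver using (solve; _:+_; _:*_; _:=_; con)

reflects-sound : ∀ {P : Set} {b} → Reflects P b → b ≡ true → P
reflects-sound (ofʸ p) _ = p

reflects-refute : ∀ {P : Set} {b} → Reflects P b → b ≡ false → ¬ P
reflects-refute (ofⁿ ¬p) _ = ¬p

reflects-complete : ∀ {P : Set} {b} → Reflects P b → P → b ≡ true
reflects-complete (ofʸ _) _ = refl
reflects-complete (ofⁿ ¬p) p = ⊥-elim (¬p p)

reflects-false : ∀ {P : Set} {b} → Reflects P b → ¬ P → b ≡ false
reflects-false (ofʸ p) ¬p = ⊥-elim (¬p p)
reflects-false (ofⁿ _) _ = refl

≡ᵇ-reflects-≡ : ∀ m n → Reflects (m ≡ n) (m ≡ᵇ n)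
≡ᵇ-reflects-≡ m n = fromEquivalence (≡ᵇ⇒≡ m n) (≡⇒≡ᵇ m n)

≡ᵇ-refl : ∀ n → (n ≡ᵇ n) ≡ true
≡ᵇ-refl n = reflects-complete (≡ᵇ-reflects-≡ n n) refl

clash : ∀ {ℓ} {A : Set ℓ} {b} → b ≡ true → b ≡ false → A
clash refl ()

∧-true : ∀ {a b} → a ∧ b ≡ true → a ≡ true × b ≡ true
∧-true {true} {true} _ = refl , refl

∨-true : ∀ {a b} → a ∨ b ≡ true → a ≡ true ⊎ b ≡ true
∨-true {true}  _ = inj₁ refl
∨-true {false} e = inj₂ e

<ᵇ-∨-≡ᵇ : ∀ r p → ((r <ᵇ p) ∨ (p ≡ᵇ r)) ≡ (r <ᵇ suc p)
<ᵇ-∨-≡ᵇ zero    zero    = refl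
<ᵇ-∨-≡ᵇ zero    (suc p) = refl
<ᵇ-∨-≡ᵇ (suc r) zero    = refl
<ᵇ-∨-≡ᵇ (suc r) (suc p) = <ᵇ-∨-≡ᵇ r p

ind : Bool → ℕ
ind b = if b then 1 else 0

ind-∧ : ∀ a b → ind (a ∧ b) ≡ ind a * ind b
ind-∧ true  b = sym (+-identityʳ (ind b))
ind-∧ false b = refl

ind-∨ : ∀ a b → (a ≡ true → b ≡ false) → ind (a ∨ b) ≡ ind a + ind b
ind-∨ true  b excl rewrite excl refl = refl
ind-∨ false b excl = refl

∑< : ℕ → (ℕ → ℕ) → ℕ
∑< N f = sum (applyUpTo f N)

infix 5 ∑<
syntax ∑< N (λ i → e) = ∑[ i < N ] e

∑<-cong : ∀ N {f g : ℕ → ℕ} → (∀ i → i < N → f i ≡ g i) → ∑< N f ≡ ∑< N g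
∑<-cong zero    eq = refl
∑<-cong (suc N) eq = cong₂ _+_ (eq 0 z<s) (∑<-cong N (λ i i<N → eq (suc i) (s<s i<N)))

∑<-suc : ∀ N (f : ℕ → ℕ) → ∑< (suc N) f ≡ ∑< N f + f N
∑<-suc zero    f = +-identityʳ (f 0)
∑<-suc (suc N) f rewrite ∑<-suc N (f ∘ suc) = sym (+-assoc (f 0) _ _)

∑<-const : ∀ N c → ∑[ _ < N ] c ≡ N * c
∑<-const zero    c = refl
∑<-const (suc N) c = cong (c +_) (∑<-const N c)

∑<-zero : ∀ N → ∑[ _ < N ] 0 ≡ 0
∑<-zero N = trans (∑<-const N 0) (*-zeroʳ N)

∑<-distrib-+ : ∀ N (f g : ℕ → ℕ) → ∑[ i < N ] (f i + g i) ≡ ∑< N f + ∑< N g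
∑<-distrib-+ zero    f g = refl
∑<-distrib-+ (suc N) f g rewrite ∑<-distrib-+ N (f ∘ suc) (g ∘ suc) =
  solve 4 (λ a b c d → (a :+ b) :+ (c :+ d) := (a :+ c) :+ (b :+ d)) refl (f 0) (g 0) _ _

*-distribˡ-∑< : ∀ N c (f : ℕ → ℕ) → ∑[ i < N ] (c * f i) ≡ c * ∑< N f
*-distribˡ-∑< zero    c f = sym (*-zeroʳ c)
*-distribˡ-∑< (suc N) c f rewrite *-distribˡ-∑< N c (f ∘ suc) = sym (*-distribˡ-+ c (f 0) _)

*-distribʳ-∑< : ∀ N c (f : ℕ → ℕ) → ∑[ i < N ] (f i * c) ≡ ∑< N f * c
*-distribʳ-∑< N c f = trans (∑<-cong N (λ i _ → *-comm (f i) c)) (trans (*-distribˡ-∑< N c f) (*-comm c _))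

∑<-+ : ∀ a b (f : ℕ → ℕ) → ∑< (a + b) f ≡ ∑< a f + (∑[ i < b ] f (a + i))
∑<-+ zero    b f = refl
∑<-+ (suc a) b f rewrite ∑<-+ a b (f ∘ suc) = sym (+-assoc (f 0) _ _)

∑<-* : ∀ k m (f : ℕ → ℕ) → ∑< (k * m) f ≡ ∑[ p < k ] ∑[ o < m ] f (p * m + o)
∑<-* zero    m f = refl
∑<-* (suc k) m f rewrite ∑<-+ m (k * m) f | ∑<-* k m (λ i → f (m + i)) =
  cong (∑< m f +_) (∑<-cong k (λ p _ → ∑<-cong m (λ o _ → cong f (sym (+-assoc m (p * m) o)))))

∑<-select : ∀ N p (f : ℕ → ℕ) → p < N → ∑[ i < N ] (ind (i ≡ᵇ p) * f i) ≡ f p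
∑<-select (suc N) zero    f _ =
  trans (cong₂ _+_ (*-identityˡ (f 0)) (∑<-zero N)) (+-identityʳ (f 0))
∑<-select (suc N) (suc p) f p<N = ∑<-select N p (f ∘ suc) (≤-pred p<N)

∑<-count-< : ∀ N j → ∑[ r < N ] ind (r <ᵇ j) ≡ N ⊓ j
∑<-count-< zero    j       = refl
∑<-count-< (suc N) zero    = ∑<-zero N
∑<-count-< (suc N) (suc j) = cong suc (∑<-count-< N j)

∑<-ind≡0 : ∀ N (B : ℕ → Bool) → ∑[ i < N ] ind (B i) ≡ 0 → ∀ i → i < N → B i ≡ false
∑<-ind≡0 (suc N) B eq zero    _ with B 0
... | false = refl
∑<-ind≡0 (suc N) B eq (suc i) i<N with B 0
... | false = ∑<-ind≡0 N (B ∘ suc) eq i (≤-pred i<N)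

sum-map-applyUpTo : ∀ N (f g : ℕ → ℕ) → sum (map g (applyUpTo f N)) ≡ ∑[ i < N ] g (f i)
sum-map-applyUpTo N f g = cong sum (map-applyUpTo f g N)

sum-map-tabulate : ∀ {a} {A : Set a} N (f : Fin N → A) (g : A → ℕ) (h : ℕ → ℕ) →
                   (∀ i → g (f i) ≡ h (toℕ i)) → sum (map g (tabulate f)) ≡ ∑< N h
sum-map-tabulate zero    f g h eq = refl
sum-map-tabulate (suc N) f g h eq =
  cong₂ _+_ (eq Fin.zero) (sum-map-tabulate N (f ∘ Fin.suc) g (h ∘ suc) (eq ∘ Fin.suc))

module _ {a} {A : Set a} where

  sum-map-zero : ∀ (xs : List A) → sum (map (λ _ → 0) xs) ≡ 0
  sum-map-zero []       = refl
  sum-map-zero (_ ∷ xs) = sum-map-zero xs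

  sum-map-+ : ∀ (f g : A → ℕ) xs → sum (map (λ x → f x + g x) xs) ≡ sum (map f xs) + sum (map g xs)
  sum-map-+ f g []       = refl
  sum-map-+ f g (x ∷ xs) rewrite sum-map-+ f g xs =
    solve 4 (λ a b c d → (a :+ b) :+ (c :+ d) := (a :+ c) :+ (b :+ d)) refl (f x) (g x) _ _

  *-distribˡ-sum-map : ∀ c (f : A → ℕ) xs → sum (map (λ x → c * f x) xs) ≡ c * sum (map f xs)
  *-distribˡ-sum-map c f []       = sym (*-zeroʳ c)
  *-distribˡ-sum-map c f (x ∷ xs) rewrite *-distribˡ-sum-map c f xs = sym (*-distribˡ-+ c (f x) _)

  sum-map-∑< : ∀ N (f : A → ℕ → ℕ) xs → sum (map (λ x → ∑< N (f x)) xs) ≡ ∑[ j < N ] sum (map (λ x → f x j) xs)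
  sum-map-∑< N f []       = sym (∑<-zero N)
  sum-map-∑< N f (x ∷ xs) rewrite sum-map-∑< N f xs = sym (∑<-distrib-+ N (f x) _)

  sum-concatMap : (f : A → List ℕ) → ∀ xs → sum (concatMap f xs) ≡ sum (map (sum ∘ f) xs)
  sum-concatMap f []       = refl
  sum-concatMap f (x ∷ xs) = trans (sum-++ (f x) _) (cong (sum (f x) +_) (sum-concatMap f xs))

sum-map-cartesianProductWith : ∀ {a b c} {A : Set a} {B : Set b} {C : Set c} (f : A → B → C) (g : C → ℕ) xs ys →
  sum (map g (cartesianProductWith f xs ys)) ≡ sum (map (λ x → sum (map (λ y → g (f x y)) ys)) xs)
sum-map-cartesianProductWith f g []       ys = refl
sum-map-cartesianProductWith f g (x ∷ xs) ys rewrite map-++ g (map (f x) ys) (cartesianProductWith f xs ys) =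
  trans (sum-++ (map g (map (f x) ys)) _)
        (cong₂ _+_ (cong sum (sym (map-∘ ys))) (sum-map-cartesianProductWith f g xs ys))

sum-map-allFin-at-0 : ∀ N .{{_ : NonZero N}} (g : Fin N → ℕ) z → (∀ c → toℕ c ≡ 0 → g c ≡ z) →
                      (∀ c → toℕ c ≢ 0 → g c ≡ 0) → sum (map g (allFin N)) ≡ z
sum-map-allFin-at-0 (suc N) g z at0 off0 = begin
  g Fin.zero + sum (map g (tabulate Fin.suc))          ≡⟨ cong₂ _+_ (at0 Fin.zero refl)
                                                              (sum-map-tabulate N Fin.suc g (λ _ → 0) (λ c → off0 (Fin.suc c) (λ ()))) ⟩
  z + (∑[ _ < N ] 0)                                   ≡⟨ cong (z +_) (∑<-zero N) ⟩
  z + 0                                                ≡⟨ +-identityʳ z ⟩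
  z                                                    ∎
  where open ≡-Reasoning

vec-ext : ∀ {a} {A : Set a} {N} (xs ys : Vec A N) → (∀ i → lookup xs i ≡ lookup ys i) → xs ≡ ys
vec-ext xs ys eq = trans (sym (Vec.tabulate∘lookup xs)) (trans (Vec.tabulate-cong eq) (Vec.tabulate∘lookup ys))

module _ {a} {A : Set a} (P : A → Bool) where

  any-true : ∀ {x} xs → x ∈ xs → P x ≡ true → any P xs ≡ true
  any-true (y ∷ xs) (here refl) e rewrite e = refl
  any-true (y ∷ xs) (there x∈)  e rewrite any-true xs x∈ e = ∨-zeroʳ (P y)

  any-true⁻ : ∀ xs → any P xs ≡ true → ∃[ x ] P x ≡ true
  any-true⁻ (x ∷ xs) e with P x in Px
  ... | true  = x , Px
  ... | false = any-true⁻ xs e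

any-cong : ∀ {a} {A : Set a} {P Q : A → Bool} xs → (∀ x → P x ≡ Q x) → any P xs ≡ any Q xs
any-cong []       eq = refl
any-cong (x ∷ xs) eq = cong₂ _∨_ (eq x) (any-cong xs eq)

foldr-select : ∀ {a} {A : Set a} (Q : A → Bool) (g : A → ℕ) d xs {x} → x ∈ xs → Q x ≡ true →
               ∃[ y ] g y ≡ foldr (λ a acc → if Q a then g a else acc) d xs
foldr-select Q g d (y ∷ xs) x∈ Qx with Q y in Qy
... | true = y , refl
foldr-select Q g d (y ∷ xs) (here refl) Qx | false = clash Qx Qy
foldr-select Q g d (y ∷ xs) (there x∈) Qx | false = foldr-select Q g d xs x∈ Qx

firstIn : ℕ → ℕ → (ℕ → Bool) → ℕ → ℕ
firstIn zero    s P d = d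
firstIn (suc N) s P d = if P s then s else firstIn N (suc s) P d

firstIn-none : ∀ N s P d → (∀ i → s ≤ i → i < s + N → P i ≡ false) → firstIn N s P d ≡ d
firstIn-none zero    s P d none = refl
firstIn-none (suc N) s P d none rewrite none s ≤-refl (m<m+n s z<s) =
  firstIn-none N (suc s) P d (λ i s<i i<s+N → none i (<⇒≤ s<i) (subst (i <_) (sym (+-suc s N)) i<s+N))

firstIn-least : ∀ N s P d r → s ≤ r → r < s + N → P r ≡ true → (∀ i → s ≤ i → i < r → P i ≡ false) →
                firstIn N s P d ≡ r
firstIn-least zero    s P d r s≤r r<s+0 _ _ = ⊥-elim (<⇒≱ r<s+0 (subst (_≤ r) (sym (+-identityʳ s)) s≤r))
firstIn-least (suc N) s P d r s≤r r<s+N Pr before with P s in Ps | m≤n⇒m<n∨m≡n s≤r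
... | true  | inj₁ s<r = clash Ps (before s ≤-refl s<r)
... | true  | inj₂ s≡r = s≡r
... | false | inj₁ s<r = firstIn-least N (suc s) P d r s<r (subst (r <_) (+-suc s N) r<s+N) Pr
                           (λ i s<i i<r → before i (<⇒≤ s<i) i<r)
... | false | inj₂ refl = clash Pr Ps

foldr-tabulate-firstIn : ∀ {a} {A : Set a} N (f : Fin N → A) (Q : A → Bool) (g : A → ℕ) (P : ℕ → Bool) s d →
  (∀ i → g (f i) ≡ s + toℕ i) → (∀ i → Q (f i) ≡ P (s + toℕ i)) →
  foldr (λ a acc → if Q a then g a else acc) d (tabulate f) ≡ firstIn N s P d
foldr-tabulate-firstIn zero    f Q g P s d gf Qf = refl
foldr-tabulate-firstIn (suc N) f Q g P s d gf Qf
  rewrite foldr-tabulate-firstIn N (f ∘ Fin.suc) Q g P (suc s) d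
            (λ i → trans (gf (Fin.suc i)) (+-suc s (toℕ i))) (λ i → trans (Qf (Fin.suc i)) (cong P (+-suc s (toℕ i))))
        | Qf Fin.zero | gf Fin.zero | +-identityʳ s = refl

module _ (q : ℕ) where

  qint-∑< : ∀ j → qint q j ≡ ∑[ i < j ] q ^ i
  qint-∑< j = sum-map-applyUpTo j id (q ^_)

  qint-suc : ∀ j → qint q (suc j) ≡ qint q j + q ^ j
  qint-suc j rewrite qint-∑< (suc j) | qint-∑< j = ∑<-suc j (q ^_)

  ∑<-q^marked-after : ∀ N (B : ℕ → Bool) →
    ∑[ b < N ] (ind (B b) * q ^ (∑[ l < N ] ind ((b <ᵇ l) ∧ B l))) ≡ qint q (∑[ l < N ] ind (B l))
  ∑<-q^marked-after zero    B = refl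
  ∑<-q^marked-after (suc N) B rewrite ∑<-q^marked-after N (B ∘ suc) with B 0
  ... | true  = trans (cong (_+ qint q K) (+-identityʳ (q ^ K))) (trans (+-comm (q ^ K) (qint q K)) (sym (qint-suc K)))
    where K = ∑[ l < N ] ind (B (suc l))
  ... | false = refl

  qfactm-suc : ∀ m j → qfactm q m (suc j) ≡ qfactm q m j * qint q (suc j * m)
  qfactm-suc m j = begin
    product (map f (upTo (suc j)))         ≡⟨ cong (product ∘ map f) (sym (upTo-∷ʳ j)) ⟩
    product (map f (upTo j List.∷ʳ j))     ≡⟨ cong product (map-++ f (upTo j) List.[ j ]) ⟩
    product (map f (upTo j) List.++ List.[ f j ]) ≡⟨ product-++ (map f (upTo j)) _ ⟩
    qfactm q m j * (f j * 1)               ≡⟨ cong (qfactm q m j *_) (*-identityʳ (f j)) ⟩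
    qfactm q m j * f j                     ∎
    where
    open ≡-Reasoning
    f : ℕ → ℕ
    f t = qint q (suc t * m)

module ModArith (d : ℕ) .{{_ : NonZero d}} where

  suc[d∸1]≡d : suc (d ∸ 1) ≡ d
  suc[d∸1]≡d = trans (+-comm 1 (d ∸ 1)) (m∸n+n≡m (>-nonZero⁻¹ d))

  [m%d+n]%d≡[m+n]%d : ∀ a b → (a % d + b) % d ≡ (a + b) % d
  [m%d+n]%d≡[m+n]%d a b = trans (%-distribˡ-+ (a % d) b d)
    (trans (cong (λ z → (z + b % d) % d) (m%n%n≡m%n a d)) (sym (%-distribˡ-+ a b d)))

  [m+n%d]%d≡[m+n]%d : ∀ a b → (a + b % d) % d ≡ (a + b) % d
  [m+n%d]%d≡[m+n]%d a b = trans (%-congˡ (+-comm a (b % d)))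
    (trans ([m%d+n]%d≡[m+n]%d b a) (%-congˡ (+-comm b a)))

  [m+[n+o]%d]%d≡[[m+n]%d+o]%d : ∀ a b c → (a + (b + c) % d) % d ≡ ((a + b) % d + c) % d
  [m+[n+o]%d]%d≡[[m+n]%d+o]%d a b c = begin
    (a + (b + c) % d) % d   ≡⟨ [m+n%d]%d≡[m+n]%d a (b + c) ⟩
    (a + (b + c)) % d       ≡⟨ cong (_% d) (sym (+-assoc a b c)) ⟩
    (a + b + c) % d         ≡⟨ sym ([m%d+n]%d≡[m+n]%d (a + b) c) ⟩
    ((a + b) % d + c) % d   ∎
    where open ≡-Reasoning

  [m+1]%d≡0⇒m≡d∸1 : ∀ {a} → a < d → (a + 1) % d ≡ 0 → a ≡ d ∸ 1
  [m+1]%d≡0⇒m≡d∸1 {a} a<d eq = trans (sym (m<n⇒m%n≡m a<d)) (%-pred-≡0 (trans (cong (_% d) (+-comm 1 a)) eq))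

  [d∸1+[1+m]%d]%d≡m%d : ∀ a → (d ∸ 1 + suc a % d) % d ≡ a % d
  [d∸1+[1+m]%d]%d≡m%d a = begin
    (d ∸ 1 + suc a % d) % d   ≡⟨ [m+n%d]%d≡[m+n]%d (d ∸ 1) (suc a) ⟩
    (d ∸ 1 + suc a) % d       ≡⟨ cong (_% d) (trans (+-suc (d ∸ 1) a) (trans (cong (_+ a) suc[d∸1]≡d) (+-comm d a))) ⟩
    (a + d) % d               ≡⟨ [m+n]%n≡m%n a d ⟩
    a % d                     ∎
    where open ≡-Reasoning

  [p*d+r]%d≡r : ∀ p {r} → r < d → (p * d + r) % d ≡ r
  [p*d+r]%d≡r p {r} r<d = trans (%-congˡ (+-comm (p * d) r)) (trans ([m+kn]%n≡m%n r p d) (m<n⇒m%n≡m r<d))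

  [p*d+r]/d≡p : ∀ p {r} → r < d → (p * d + r) / d ≡ p
  [p*d+r]/d≡p p {r} r<d =
    trans (+-distrib-/ (p * d) r (subst (_< d) (sym (cong₂ _+_ (m*n%n≡0 p d) (m<n⇒m%n≡m r<d))) r<d))
          (trans (cong₂ _+_ (m*n/n≡m p d) (m<n⇒m/n≡0 r<d)) (+-identityʳ p))

  divMod-unique : ∀ p p′ {r r′} → r < d → r′ < d → p * d + r ≡ p′ * d + r′ → p ≡ p′ × r ≡ r′
  divMod-unique p p′ r<d r′<d eq =
    trans (sym ([p*d+r]/d≡p p r<d)) (trans (cong (_/ d) eq) ([p*d+r]/d≡p p′ r′<d)) ,
    trans (sym ([p*d+r]%d≡r p r<d)) (trans (cong (_% d) eq) ([p*d+r]%d≡r p′ r′<d))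

  m≡[m/d]*d+m%d : ∀ a → a ≡ (a / d) * d + a % d
  m≡[m/d]*d+m%d a = trans (m≡m%n+[m/n]*n a d) (+-comm (a % d) _)

  [m+t+[d∸t%d]]%d≡m%d : ∀ a t → (a + t + (d ∸ t % d)) % d ≡ a % d
  [m+t+[d∸t%d]]%d≡m%d a t = begin
    (a + t + (d ∸ t % d)) % d                     ≡⟨ %-congˡ (cong (λ z → a + z + (d ∸ t % d)) (m≡m%n+[m/n]*n t d)) ⟩
    (a + (t % d + t / d * d) + (d ∸ t % d)) % d   ≡⟨ %-congˡ (+-assoc a _ _) ⟩
    (a + (t % d + t / d * d + (d ∸ t % d))) % d   ≡⟨ %-congˡ (cong (a +_) shuffle) ⟩
    (a + suc (t / d) * d) % d                     ≡⟨ [m+kn]%n≡m%n a (suc (t / d)) d ⟩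
    a % d                                         ∎
    where
    open ≡-Reasoning
    shuffle : t % d + t / d * d + (d ∸ t % d) ≡ d + t / d * d
    shuffle = trans (+-assoc (t % d) _ _) (trans (cong (t % d +_) (+-comm (t / d * d) _))
      (trans (sym (+-assoc (t % d) _ _)) (cong (_+ t / d * d) (m+[n∸m]≡n (<⇒≤ (m%n<n t d))))))

  %-shift-cancel : ∀ a t → ((a + t) % d + (d ∸ t % d)) % d ≡ a % d
  %-shift-cancel a t = trans ([m%d+n]%d≡[m+n]%d (a + t) _) ([m+t+[d∸t%d]]%d≡m%d a t)

  %-unshift-cancel : ∀ a t → ((a + (d ∸ t % d)) % d + t) % d ≡ a % d
  %-unshift-cancel a t = trans ([m%d+n]%d≡[m+n]%d (a + (d ∸ t % d)) t)
    (trans (%-congˡ (trans (+-assoc a _ t) (trans (cong (a +_) (+-comm _ t)) (sym (+-assoc a t _)))))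
           ([m+t+[d∸t%d]]%d≡m%d a t))

  +-%-injectiveˡ : ∀ t {a b} → a < d → b < d → (a + t) % d ≡ (b + t) % d → a ≡ b
  +-%-injectiveˡ t {a} {b} a<d b<d eq = begin
    a                                  ≡⟨ sym (m<n⇒m%n≡m a<d) ⟩
    a % d                              ≡⟨ sym (%-shift-cancel a t) ⟩
    ((a + t) % d + (d ∸ t % d)) % d    ≡⟨ cong (λ z → (z + (d ∸ t % d)) % d) eq ⟩
    ((b + t) % d + (d ∸ t % d)) % d    ≡⟨ %-shift-cancel b t ⟩
    b % d                              ≡⟨ m<n⇒m%n≡m b<d ⟩
    b                                  ∎
    where open ≡-Reasoning

  rotate : ℕ → Fin d → Fin d
  rotate t c = fromℕ< (m%n<n (toℕ c + t) d)

  toℕ-rotate : ∀ t c → toℕ (rotate t c) ≡ (toℕ c + t) % d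
  toℕ-rotate t c = Fin.toℕ-fromℕ< _

  rotate-inverse : ∀ t c → toℕ c ≡ (toℕ (rotate (d ∸ t % d) c) + t) % d
  rotate-inverse t c = sym (begin
    (toℕ (rotate (d ∸ t % d) c) + t) % d       ≡⟨ cong (λ z → (z + t) % d) (toℕ-rotate (d ∸ t % d) c) ⟩
    ((toℕ c + (d ∸ t % d)) % d + t) % d         ≡⟨ %-unshift-cancel (toℕ c) t ⟩
    toℕ c % d                                   ≡⟨ m<n⇒m%n≡m (Fin.toℕ<n c) ⟩
    toℕ c                                       ∎)
    where open ≡-Reasoning

p*m+r<k*m : ∀ {p k r m} → p < k → r < m → p * m + r < k * m
p*m+r<k*m {p} {k} {r} {m} p<k r<m =
  ≤-trans (+-monoʳ-< (p * m) r<m) (≤-trans (≤-reflexive (+-comm (p * m) m)) (*-monoˡ-≤ m p<k))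

module Encoding (m k : ℕ) .{{_ : NonZero m}} where
  open ModArith m

  -- A base i with code just (p , o) lies in the orbit S_(p m + 1), …, S_(p m + m), its
  -- colour-c element i^c in block S_(p m + 1 + (o + c) mod m); a base with code nothing lies in S_0.
  Code : Set
  Code = Maybe (Fin k × Fin m)

  block : Code → ℕ → ℕ
  block nothing        c = 0
  block (just (p , o)) c = suc (toℕ p * m + (toℕ o + c) % m)

  block<1+k*m : ∀ x c → block x c < suc (k * m)
  block<1+k*m nothing        c = z<s
  block<1+k*m (just (p , o)) c = s<s (p*m+r<k*m (Fin.toℕ<n p) (m%n<n _ m))

  inOrbit : Code → ℕ → Bool
  inOrbit nothing         r = false
  inOrbit (just (p , _))  r = toℕ p ≡ᵇ r

  colour₀ : Fin m
  colour₀ = fromℕ< (>-nonZero⁻¹ m)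

  block₀-injective : ∀ x y → block x 0 ≡ block y 0 → x ≡ y
  block₀-injective nothing        nothing          _  = refl
  block₀-injective (just (p , o)) (just (p′ , o′)) eq
    with divMod-unique (toℕ p) (toℕ p′) (m%n<n _ m) (m%n<n _ m) (suc-injective eq)
  ... | p≡p′ , o≡o′ = cong₂ (λ a b → just (a , b)) (Fin.toℕ-injective p≡p′) (Fin.toℕ-injective (begin
    toℕ o                ≡⟨ sym (m<n⇒m%n≡m (Fin.toℕ<n o)) ⟩
    toℕ o % m            ≡⟨ cong (_% m) (sym (+-identityʳ (toℕ o))) ⟩
    (toℕ o + 0) % m      ≡⟨ o≡o′ ⟩
    (toℕ o′ + 0) % m     ≡⟨ cong (_% m) (+-identityʳ (toℕ o′)) ⟩
    toℕ o′ % m           ≡⟨ m<n⇒m%n≡m (Fin.toℕ<n o′) ⟩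
    toℕ o′               ∎))
    where open ≡-Reasoning

  colourInto : Fin m → ℕ → Fin m
  colourInto o l = fromℕ< (m%n<n (l + (m ∸ toℕ o % m)) m)

  colourInto-correct : ∀ o l → (toℕ o + toℕ (colourInto o l)) % m ≡ l % m
  colourInto-correct o l = begin
    (toℕ o + toℕ (colourInto o l)) % m          ≡⟨ cong (_% m) (+-comm (toℕ o) _) ⟩
    (toℕ (colourInto o l) + toℕ o) % m          ≡⟨ cong (λ z → (z + toℕ o) % m) (Fin.toℕ-fromℕ< _) ⟩
    ((l + (m ∸ toℕ o % m)) % m + toℕ o) % m     ≡⟨ %-unshift-cancel l (toℕ o) ⟩
    l % m                                       ∎
    where open ≡-Reasoning

  block≡1+⇒inOrbit : ∀ x c l → block x c ≡ suc l → inOrbit x (l / m) ≡ true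
  block≡1+⇒inOrbit (just (p , o)) c l eq = reflects-complete (≡ᵇ-reflects-≡ _ _) (begin
    toℕ p                                ≡⟨ sym ([p*d+r]/d≡p (toℕ p) (m%n<n (toℕ o + c) m)) ⟩
    (toℕ p * m + (toℕ o + c) % m) / m    ≡⟨ cong (_/ m) (suc-injective eq) ⟩
    l / m                                ∎)
    where open ≡-Reasoning

  inOrbit⇒block≡1+ : ∀ x l → inOrbit x (l / m) ≡ true → Σ[ c ∈ Fin m ] block x (toℕ c) ≡ suc l
  inOrbit⇒block≡1+ (just (p , o)) l e = colourInto o l , cong suc (begin
    toℕ p * m + (toℕ o + toℕ (colourInto o l)) % m
      ≡⟨ cong₂ (λ a b → a * m + b) (reflects-sound (≡ᵇ-reflects-≡ (toℕ p) (l / m)) e) (colourInto-correct o l) ⟩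
    l / m * m + l % m                                ≡⟨ sym (m≡[m/d]*d+m%d l) ⟩
    l                                                ∎)
    where open ≡-Reasoning

  any-block≡1+ : ∀ x l → any (λ c → block x (toℕ c) ≡ᵇ suc l) (allFin m) ≡ inOrbit x (l / m)
  any-block≡1+ x l = ⇔→≡ (mk⇔ to from)
    where
    to : any (λ c → block x (toℕ c) ≡ᵇ suc l) (allFin m) ≡ true → inOrbit x (l / m) ≡ true
    to e with any-true⁻ _ (allFin m) e
    ... | c , eq = block≡1+⇒inOrbit x (toℕ c) l (reflects-sound (≡ᵇ-reflects-≡ _ _) eq)
    from : inOrbit x (l / m) ≡ true → any (λ c → block x (toℕ c) ≡ᵇ suc l) (allFin m) ≡ true
    from e with inOrbit⇒block≡1+ x l e
    ... | c , eq = any-true _ (allFin m) (∈-allFin c) (reflects-complete (≡ᵇ-reflects-≡ (block x (toℕ c)) (suc l)) eq)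

  infixl 5 _▹_
  data Codes : ℕ → Set where
    []  : Codes 0
    _▹_ : ∀ {n} → Codes n → Code → Codes (suc n)

  codeAt : ∀ {n} → Codes n → ℕ → Code
  codeAt []            i = nothing
  codeAt (_▹_ {n} V x) i = if i ≡ᵇ n then x else codeAt V i

  codeAt-▹-< : ∀ {n} (V : Codes n) x {i} → i < n → codeAt (V ▹ x) i ≡ codeAt V i
  codeAt-▹-< {n} V x {i} i<n rewrite reflects-false (≡ᵇ-reflects-≡ i n) (<⇒≢ i<n) = refl

  codeAt-▹-last : ∀ {n} (V : Codes n) x → codeAt (V ▹ x) n ≡ x
  codeAt-▹-last {n} V x rewrite ≡ᵇ-refl n = refl

  encodeBase : Code → Vec (Fin (suc (k * m))) m
  encodeBase x = Vec.tabulate λ c → fromℕ< (block<1+k*m x (toℕ c))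

  encode : ∀ {n} → Codes n → Label m n k
  encode V = Vec.tabulate λ i → encodeBase (codeAt V (toℕ i))

  lab-encode : ∀ {n} (V : Codes n) i c → lab m n k (encode V) i c ≡ block (codeAt V (toℕ i)) (toℕ c)
  lab-encode V i c = begin
    toℕ (lookup (lookup (encode V) i) c)          ≡⟨ cong (λ row → toℕ (lookup row c)) (Vec.lookup∘tabulate _ i) ⟩
    toℕ (lookup (encodeBase (codeAt V (toℕ i))) c) ≡⟨ cong toℕ (Vec.lookup∘tabulate _ c) ⟩
    toℕ (fromℕ< _)                                 ≡⟨ Fin.toℕ-fromℕ< _ ⟩
    block (codeAt V (toℕ i)) (toℕ c)               ∎
    where open ≡-Reasoning

  uses : ∀ {n} → Codes n → ℕ → Bool
  uses []      r = false
  uses (V ▹ x) r = uses V r ∨ inOrbit x r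

  -- leader V r is the least base in orbit r, and n if the orbit is empty.
  leader : ∀ {n} → Codes n → ℕ → ℕ
  leader []            r = 0
  leader (_▹_ {n} V x) r = if uses V r then leader V r else if inOrbit x r then n else suc n

  uses-intro : ∀ {n} (V : Codes n) r i → i < n → inOrbit (codeAt V i) r ≡ true → uses V r ≡ true
  uses-intro (_▹_ {n} V x) r i i<1+n e with m<1+n⇒m<n∨m≡n i<1+n
  ... | inj₁ i<n  rewrite uses-intro V r i i<n (trans (cong (λ y → inOrbit y r) (sym (codeAt-▹-< V x i<n))) e) = refl
  ... | inj₂ refl = trans (cong (uses V r ∨_) (trans (cong (λ y → inOrbit y r) (sym (codeAt-▹-last V x))) e)) (∨-zeroʳ _)

  leader-unused : ∀ {n} (V : Codes n) r → uses V r ≡ false → leader V r ≡ n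
  leader-unused []      r _ = refl
  leader-unused (V ▹ x) r e with uses V r | inOrbit x r
  ... | false | false = refl

  leader-▹-used : ∀ {n} (V : Codes n) x r → uses V r ≡ true → leader (V ▹ x) r ≡ leader V r
  leader-▹-used V x r used rewrite used = refl

  leader<n : ∀ {n} (V : Codes n) r → uses V r ≡ true → leader V r < n
  leader<n (V ▹ x) r e with uses V r in u | inOrbit x r
  ... | true  | _    = m<n⇒m<1+n (leader<n V r u)
  ... | false | true = ≤-refl

  leader-inOrbit : ∀ {n} (V : Codes n) r → uses V r ≡ true → inOrbit (codeAt V (leader V r)) r ≡ true
  leader-inOrbit (V ▹ x) r e with uses V r in u | inOrbit x r in o
  ... | true  | _    = trans (cong (λ y → inOrbit y r) (codeAt-▹-< V x (leader<n V r u))) (leader-inOrbit V r u)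
  ... | false | true = trans (cong (λ y → inOrbit y r) (codeAt-▹-last V x)) o

  leader-minimal : ∀ {n} (V : Codes n) r i → i < n → inOrbit (codeAt V i) r ≡ true → leader V r ≤ i
  leader-minimal (_▹_ {n} V x) r i i<1+n e with uses V r in u | inOrbit x r in o | m<1+n⇒m<n∨m≡n i<1+n
  ... | true  | _     | inj₁ i<n  = leader-minimal V r i i<n (trans (cong (λ y → inOrbit y r) (sym (codeAt-▹-< V x i<n))) e)
  ... | true  | _     | inj₂ refl = <⇒≤ (leader<n V r u)
  ... | false | _     | inj₁ i<n  = clash (uses-intro V r i i<n (trans (cong (λ y → inOrbit y r) (sym (codeAt-▹-< V x i<n))) e)) u
  ... | false | true  | inj₂ refl = ≤-refl
  ... | false | false | inj₂ refl = clash (trans (cong (λ y → inOrbit y r) (sym (codeAt-▹-last V x))) e) o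

  firstIn-inOrbit≡leader : ∀ {n} (V : Codes n) r → firstIn n 0 (λ i → inOrbit (codeAt V i) r) n ≡ leader V r
  firstIn-inOrbit≡leader {n} V r with uses V r in u
  ... | true  = firstIn-least n 0 _ n (leader V r) z≤n (leader<n V r u) (leader-inOrbit V r u)
                  (λ i _ i<lead → ¬-not (λ e → <⇒≱ i<lead (leader-minimal V r i (<-≤-trans i<lead (<⇒≤ (leader<n V r u))) e)))
  ... | false = trans (firstIn-none n 0 _ n (λ i _ i<n → ¬-not (λ e → clash (uses-intro V r i i<n e) u)))
                      (sym (leader-unused V r u))

  minb-encode : ∀ {n} (V : Codes n) l → minb m n k (encode V) (suc l) ≡ leader V (l / m)
  minb-encode {n} V l = trans
    (foldr-tabulate-firstIn n id _ toℕ (λ i → inOrbit (codeAt V i) (l / m)) 0 n (λ _ → refl)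
      (λ i → trans (any-cong (allFin m) (λ c → cong (_≡ᵇ suc l) (lab-encode V i c))) (any-block≡1+ (codeAt V (toℕ i)) l)))
    (firstIn-inOrbit≡leader V (l / m))

  -- l stands for the block S_(l+1), whose least base is the leader of orbit l / m.
  invCodes : ∀ {n} → Codes n → ℕ
  invCodes {n} V = ∑[ i < n ] ∑[ l < k * m ] ind ((block (codeAt V i) 0 <ᵇ suc l) ∧ (leader V (l / m) ≤ᵇ i))

  inv-encode : ∀ {n} (V : Codes n) → inv m n k (encode V) ≡ invCodes V
  inv-encode {n} V = trans (sum-concatMap (λ i → List.concatMap (row i) (allFin m)) (allFin n))
    (sum-map-tabulate n id _ _ λ i →
      trans (sum-concatMap (row i) (allFin m)) (sum-map-allFin-at-0 m (sum ∘ row i) _ (colour0 i) (colour≢0 i)))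
    where
    f = encode V
    term : Fin n → Fin m → ℕ → ℕ
    term i c l = ind ((toℕ c ≡ᵇ 0) ∧ (lab m n k f i c <ᵇ l) ∧ (minb m n k f l ≤ᵇ toℕ i))
    row : Fin n → Fin m → List ℕ
    row i c = map (term i c) (map suc (upTo (k * m)))
    colour0 : ∀ i c → toℕ c ≡ 0 → sum (map (term i c) (map suc (upTo (k * m)))) ≡
              ∑[ l < k * m ] ind ((block (codeAt V (toℕ i)) 0 <ᵇ suc l) ∧ (leader V (l / m) ≤ᵇ toℕ i))
    colour0 i c c≡0 = begin
      sum (map (term i c) (map suc (upTo (k * m))))  ≡⟨ cong sum (sym (map-∘ (upTo (k * m)))) ⟩
      sum (map (term i c ∘ suc) (upTo (k * m)))      ≡⟨ sum-map-applyUpTo (k * m) id (term i c ∘ suc) ⟩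
      ∑[ l < k * m ] term i c (suc l)                ≡⟨ ∑<-cong (k * m) (λ l _ → cong₂ (λ a b → ind (a ∧ b))
                                                          (cong (_≡ᵇ 0) c≡0)
                                                          (cong₂ _∧_ (cong (_<ᵇ suc l) (trans (lab-encode V i c) (cong (block _) c≡0)))
                                                                     (cong (_≤ᵇ toℕ i) (minb-encode V l)))) ⟩
      ∑[ l < k * m ] ind ((block (codeAt V (toℕ i)) 0 <ᵇ suc l) ∧ (leader V (l / m) ≤ᵇ toℕ i)) ∎
      where open ≡-Reasoning
    colour≢0 : ∀ i c → toℕ c ≢ 0 → sum (map (term i c) (map suc (upTo (k * m)))) ≡ 0
    colour≢0 i c c≢0 rewrite reflects-false (≡ᵇ-reflects-≡ (toℕ c) 0) c≢0 = sum-map-zero (map suc (upTo (k * m)))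

  newInversions : Code → (ℕ → Bool) → ℕ
  newInversions x U = ∑[ l < k * m ] ind ((block x 0 <ᵇ suc l) ∧ U (l / m))

  leader-▹-≤ᵇ : ∀ {n} (V : Codes n) x r {i} → i < n → (leader (V ▹ x) r ≤ᵇ i) ≡ (leader V r ≤ᵇ i)
  leader-▹-≤ᵇ {n} V x r {i} i<n with uses V r in u
  ... | true = refl
  ... | false rewrite leader-unused V r u with inOrbit x r
  ...   | true  = refl
  ...   | false = trans (reflects-false (≤ᵇ-reflects-≤ _ _) (<⇒≱ (m<n⇒m<1+n i<n)))
                        (sym (reflects-false (≤ᵇ-reflects-≤ _ _) (<⇒≱ i<n)))

  leader-▹-≤ᵇ-last : ∀ {n} (V : Codes n) x r → (leader (V ▹ x) r ≤ᵇ n) ≡ uses (V ▹ x) r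
  leader-▹-≤ᵇ-last {n} V x r with uses V r in u
  ... | true = reflects-complete (≤ᵇ-reflects-≤ _ _) (<⇒≤ (leader<n V r u))
  ... | false with inOrbit x r
  ...   | true  = reflects-complete (≤ᵇ-reflects-≤ n n) ≤-refl
  ...   | false = reflects-false (≤ᵇ-reflects-≤ (suc n) n) (<-irrefl refl)

  invCodes-▹ : ∀ {n} (V : Codes n) x → invCodes (V ▹ x) ≡ invCodes V + newInversions x (uses (V ▹ x))
  invCodes-▹ {n} V x = trans (∑<-suc n _) (cong₂ _+_
    (∑<-cong n (λ i i<n → ∑<-cong (k * m) (λ l _ → cong ind (cong₂ _∧_
      (cong (λ y → block y 0 <ᵇ suc l) (codeAt-▹-< V x i<n)) (leader-▹-≤ᵇ V x (l / m) i<n)))))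
    (∑<-cong (k * m) (λ l _ → cong ind (cong₂ _∧_
      (cong (λ y → block y 0 <ᵇ suc l) (codeAt-▹-last V x)) (leader-▹-≤ᵇ-last V x (l / m))))))

  alphabet : List Code
  alphabet = nothing ∷ map just (List.cartesianProduct (allFin k) (allFin m))

  allCodes : ∀ n → List (Codes n)
  allCodes zero    = [] ∷ []
  allCodes (suc n) = List.cartesianProductWith _▹_ (allCodes n) alphabet

module OrbitSets (m k : ℕ) .{{_ : NonZero m}} where
  open Encoding m k

  size : (ℕ → Bool) → ℕ
  size U = ∑[ r < k ] ind (U r)

  _∖_ : (ℕ → Bool) → ℕ → (ℕ → Bool)
  (U ∖ p) r = U r ∧ not (p ≡ᵇ r)

  below : ℕ → ℕ → Bool
  below j r = r <ᵇ j

  size-below : ∀ {j} → j ≤ k → size (below j) ≡ j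
  size-below {j} j≤k = trans (∑<-count-< k j) (m≥n⇒m⊓n≡n j≤k)

  size-∖ : ∀ U p → p < k → U p ≡ true → size U ≡ suc (size (U ∖ p))
  size-∖ U p p<k Up = begin
    size U                                         ≡⟨ ∑<-cong k (λ r _ → split r) ⟩
    ∑[ r < k ] (ind ((U ∖ p) r) + ind (r ≡ᵇ p) * 1) ≡⟨ ∑<-distrib-+ k _ _ ⟩
    size (U ∖ p) + (∑[ r < k ] ind (r ≡ᵇ p) * 1)    ≡⟨ cong (size (U ∖ p) +_) (∑<-select k p (λ _ → 1) p<k) ⟩
    size (U ∖ p) + 1                               ≡⟨ +-comm (size (U ∖ p)) 1 ⟩
    suc (size (U ∖ p))                             ∎
    where
    open ≡-Reasoning
    split : ∀ r → ind (U r) ≡ ind ((U ∖ p) r) + ind (r ≡ᵇ p) * 1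
    split r with r ≡ᵇ p in r≡ᵇp
    ... | false rewrite reflects-false (≡ᵇ-reflects-≡ p r) (λ p≡r → reflects-refute (≡ᵇ-reflects-≡ r p) r≡ᵇp (sym p≡r))
                      | ∧-identityʳ (U r) = sym (+-identityʳ _)
    ... | true  rewrite reflects-sound (≡ᵇ-reflects-≡ r p) r≡ᵇp | Up | ≡ᵇ-refl p = refl

  UsesExactly : ∀ {n} → Codes n → (ℕ → Bool) → Set
  UsesExactly V U = ∀ r → r < k → uses V r ≡ U r

  -- Recursion on V: the last base either joins an orbit used by the earlier ones or opens it.
  usesExactlyᵇ : ∀ {n} → (ℕ → Bool) → Codes n → Bool
  usesExactlyᵇ U []                 = size U ≡ᵇ 0
  usesExactlyᵇ U (V ▹ nothing)      = usesExactlyᵇ U V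
  usesExactlyᵇ U (V ▹ just (p , o)) = U (toℕ p) ∧ (usesExactlyᵇ U V ∨ usesExactlyᵇ (U ∖ toℕ p) V)

  ∖-∨-≡ᵇ : ∀ (U : ℕ → Bool) p r → ((U ∖ p) r ∨ (p ≡ᵇ r)) ≡ (U r ∨ (p ≡ᵇ r))
  ∖-∨-≡ᵇ U p r with p ≡ᵇ r
  ... | true  = trans (∨-zeroʳ _) (sym (∨-zeroʳ _))
  ... | false = cong (_∨ false) (∧-identityʳ (U r))

  ∨-≡ᵇ-absorb : ∀ (U : ℕ → Bool) p r → U p ≡ true → (U r ∨ (p ≡ᵇ r)) ≡ U r
  ∨-≡ᵇ-absorb U p r Up with p ≡ᵇ r in p≡ᵇr
  ... | true  = trans (∨-zeroʳ (U r)) (sym (subst (λ z → U z ≡ true) (reflects-sound (≡ᵇ-reflects-≡ p r) p≡ᵇr) Up))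
  ... | false = ∨-identityʳ (U r)

  usesExactlyᵇ-sound : ∀ {n} U (V : Codes n) → usesExactlyᵇ U V ≡ true → UsesExactly V U
  usesExactlyᵇ-sound U []      e r r<k = sym (∑<-ind≡0 k U (reflects-sound (≡ᵇ-reflects-≡ _ 0) e) r r<k)
  usesExactlyᵇ-sound U (V ▹ nothing) e r r<k = trans (∨-identityʳ _) (usesExactlyᵇ-sound U V e r r<k)
  usesExactlyᵇ-sound U (V ▹ just (p , o)) e r r<k with ∧-true {U (toℕ p)} e
  ... | Up , e′ with ∨-true {usesExactlyᵇ U V} e′
  ...   | inj₁ old rewrite usesExactlyᵇ-sound U V old r r<k = ∨-≡ᵇ-absorb U (toℕ p) r Up
  ...   | inj₂ new rewrite usesExactlyᵇ-sound (U ∖ toℕ p) V new r r<k =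
          trans (∖-∨-≡ᵇ U (toℕ p) r) (∨-≡ᵇ-absorb U (toℕ p) r Up)

  UsesExactly-▹-orbit : ∀ {n} (V : Codes n) p o U → UsesExactly (V ▹ just (p , o)) U → U (toℕ p) ≡ true
  UsesExactly-▹-orbit V p o U h =
    trans (sym (h (toℕ p) (Fin.toℕ<n p))) (trans (cong (uses V (toℕ p) ∨_) (≡ᵇ-refl (toℕ p))) (∨-zeroʳ _))

  UsesExactly-▹-joins : ∀ {n} (V : Codes n) p o U → UsesExactly (V ▹ just (p , o)) U → uses V (toℕ p) ≡ true →
                      UsesExactly V U
  UsesExactly-▹-joins V p o U h used r r<k with toℕ p ≡ᵇ r in p≡ᵇr
  ... | false = trans (sym (∨-identityʳ _)) (trans (cong (uses V r ∨_) (sym p≡ᵇr)) (h r r<k))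
  ... | true = subst (λ z → uses V z ≡ U z) (reflects-sound (≡ᵇ-reflects-≡ _ _) p≡ᵇr)
                 (trans used (sym (UsesExactly-▹-orbit V p o U h)))

  UsesExactly-▹-opens : ∀ {n} (V : Codes n) p o U → UsesExactly (V ▹ just (p , o)) U → uses V (toℕ p) ≡ false →
                      UsesExactly V (U ∖ toℕ p)
  UsesExactly-▹-opens V p o U h fresh r r<k with toℕ p ≡ᵇ r in p≡ᵇr
  ... | false = trans (sym (∨-identityʳ _)) (trans (cong (uses V r ∨_) (sym p≡ᵇr)) (trans (h r r<k) (sym (∧-identityʳ (U r)))))
  ... | true = trans (subst (λ z → uses V z ≡ false) (reflects-sound (≡ᵇ-reflects-≡ _ _) p≡ᵇr) fresh) (sym (∧-zeroʳ (U r)))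

  usesExactlyᵇ-complete : ∀ {n} U (V : Codes n) → UsesExactly V U → usesExactlyᵇ U V ≡ true
  usesExactlyᵇ-complete U [] h = reflects-complete (≡ᵇ-reflects-≡ _ 0)
    (trans (∑<-cong k (λ r r<k → cong ind (sym (h r r<k)))) (∑<-zero k))
  usesExactlyᵇ-complete U (V ▹ nothing) h =
    usesExactlyᵇ-complete U V (λ r r<k → trans (sym (∨-identityʳ _)) (h r r<k))
  usesExactlyᵇ-complete U (V ▹ just (p , o)) h
    rewrite sym (h (toℕ p) (Fin.toℕ<n p)) | ≡ᵇ-refl (toℕ p) | ∨-zeroʳ (uses V (toℕ p)) with uses V (toℕ p) in u
  ... | true  rewrite usesExactlyᵇ-complete U V (UsesExactly-▹-joins V p o U h u) = refl
  ... | false rewrite usesExactlyᵇ-complete (U ∖ toℕ p) V (UsesExactly-▹-opens V p o U h u) = ∨-zeroʳ _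

  usesExactlyᵇ-exclusive : ∀ {n} U (V : Codes n) p → p < k → U p ≡ true →
                           usesExactlyᵇ U V ≡ true → usesExactlyᵇ (U ∖ p) V ≡ false
  usesExactlyᵇ-exclusive U V p p<k Up old with usesExactlyᵇ (U ∖ p) V in new
  ... | false = refl
  ... | true  = clash (trans (sym (usesExactlyᵇ-sound (U ∖ p) V new p p<k)) (trans (usesExactlyᵇ-sound U V old p p<k) Up))
                      (trans (cong (λ b → U p ∧ not b) (≡ᵇ-refl p)) (∧-zeroʳ (U p)))

  -- Codes standard for j orbits: the occupied orbits are 0, …, j - 1, opened in this order by bases
  -- of offset m - 1; the last base either joins an occupied orbit or opens orbit j - 1.
  standardᵇ : ∀ {n} → ℕ → Codes n → Bool
  standardᵇ j []                 = j ≡ᵇ 0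
  standardᵇ j (V ▹ nothing)      = standardᵇ j V
  standardᵇ j (V ▹ just (p , o)) = ((toℕ p <ᵇ j) ∧ standardᵇ j V)
                                 ∨ ((suc (toℕ p) ≡ᵇ j) ∧ (toℕ o ≡ᵇ m ∸ 1) ∧ standardᵇ (toℕ p) V)

  standardᵇ-uses : ∀ {n} j (V : Codes n) → standardᵇ j V ≡ true → ∀ r → uses V r ≡ below j r
  standardᵇ-uses j []      e r rewrite reflects-sound (≡ᵇ-reflects-≡ j 0) e = refl
  standardᵇ-uses j (V ▹ nothing) e r = trans (∨-identityʳ _) (standardᵇ-uses j V e r)
  standardᵇ-uses j (V ▹ just (p , o)) e r with ∨-true {(toℕ p <ᵇ j) ∧ standardᵇ j V} e
  ... | inj₁ joins with ∧-true {toℕ p <ᵇ j} joins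
  ...   | p<j , std rewrite standardᵇ-uses j V std r = ∨-≡ᵇ-absorb (below j) (toℕ p) r p<j
  standardᵇ-uses j (V ▹ just (p , o)) e r | inj₂ opens with ∧-true {suc (toℕ p) ≡ᵇ j} opens
  ... | j≡ , rest rewrite sym (reflects-sound (≡ᵇ-reflects-≡ (suc (toℕ p)) j) j≡)
                        | standardᵇ-uses (toℕ p) V (proj₂ (∧-true {toℕ o ≡ᵇ m ∸ 1} rest)) r = <ᵇ-∨-≡ᵇ r (toℕ p)

  standardᵇ-exact : ∀ {n} j (V : Codes n) → standardᵇ j V ≡ true → UsesExactly V (below j)
  standardᵇ-exact j V std r _ = standardᵇ-uses j V std r

  standardᵇ-exclusive : ∀ {n} p (V : Codes n) → standardᵇ (suc p) V ≡ true → standardᵇ p V ≡ false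
  standardᵇ-exclusive p V std₁ with standardᵇ p V in std₀
  ... | false = refl
  ... | true  = clash (trans (standardᵇ-uses (suc p) V std₁ p) (reflects-complete (<ᵇ-reflects-< p (suc p)) ≤-refl))
                      (trans (standardᵇ-uses p V std₀ p) (reflects-false (<ᵇ-reflects-< p p) (<-irrefl refl)))

module WeightedSums (m k : ℕ) .{{_ : NonZero m}} (q : ℕ) where
  open ModArith m
  open Encoding m k
  open OrbitSets m k

  ∑Codes : ∀ n → (Codes n → ℕ) → ℕ
  ∑Codes n F = sum (map F (allCodes n))

  weight : ∀ {n} → Codes n → ℕ
  weight V = q ^ invCodes V

  sum-map-alphabet : ∀ (F : Code → ℕ) (h : ℕ → ℕ → ℕ) → (∀ p o → F (just (p , o)) ≡ h (toℕ p) (toℕ o)) →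
                     sum (map F alphabet) ≡ F nothing + (∑[ p < k ] ∑[ o < m ] h p o)
  sum-map-alphabet F h eq = cong (F nothing +_) (begin
    sum (map F (map just (List.cartesianProduct (allFin k) (allFin m))))
      ≡⟨ cong sum (sym (map-∘ (List.cartesianProduct (allFin k) (allFin m)))) ⟩
    sum (map (F ∘ just) (List.cartesianProduct (allFin k) (allFin m)))
      ≡⟨ sum-map-cartesianProductWith _,_ (F ∘ just) (allFin k) (allFin m) ⟩
    sum (map (λ p → sum (map (λ o → F (just (p , o))) (allFin m))) (allFin k))
      ≡⟨ sum-map-tabulate k id _ _ (λ p → sum-map-tabulate m id _ _ (eq p)) ⟩
    ∑[ p < k ] ∑[ o < m ] h p o                                            ∎)
    where open ≡-Reasoning

  ∑Codes-▹ : ∀ n (F : Codes (suc n) → ℕ) (g : Codes n → ℕ) (g′ : ℕ → Codes n → ℕ) a (c c′ : ℕ → ℕ → ℕ) →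
    (∀ V → F (V ▹ nothing) ≡ a * g V) →
    (∀ V p o → F (V ▹ just (p , o)) ≡ c (toℕ p) (toℕ o) * g V + c′ (toℕ p) (toℕ o) * g′ (toℕ p) V) →
    ∑Codes (suc n) F ≡ a * ∑Codes n g + (∑[ p < k ] ∑[ o < m ] (c p o * ∑Codes n g + c′ p o * ∑Codes n (g′ p)))
  ∑Codes-▹ n F g g′ a c c′ F-nothing F-just = begin
    ∑Codes (suc n) F
      ≡⟨ sum-map-cartesianProductWith _▹_ F (allCodes n) alphabet ⟩
    sum (map (λ V → sum (map (λ x → F (V ▹ x)) alphabet)) (allCodes n))
      ≡⟨ cong sum (map-cong (λ V → trans (sum-map-alphabet _ (λ p o → H p o V) (F-just V))
                                         (cong (_+ (∑[ p < k ] ∑[ o < m ] H p o V)) (F-nothing V))) (allCodes n)) ⟩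
    sum (map (λ V → a * g V + (∑[ p < k ] ∑[ o < m ] H p o V)) (allCodes n))
      ≡⟨ sum-map-+ _ _ (allCodes n) ⟩
    sum (map (λ V → a * g V) (allCodes n)) + sum (map (λ V → ∑[ p < k ] ∑[ o < m ] H p o V) (allCodes n))
      ≡⟨ cong₂ _+_ (*-distribˡ-sum-map a g (allCodes n)) (trans (sum-map-∑< k _ (allCodes n))
           (∑<-cong k (λ p _ → trans (sum-map-∑< m _ (allCodes n)) (∑<-cong m (λ o _ → split p o))))) ⟩
    a * ∑Codes n g + (∑[ p < k ] ∑[ o < m ] (c p o * ∑Codes n g + c′ p o * ∑Codes n (g′ p)))
      ∎
    where
    open ≡-Reasoning
    H : ℕ → ℕ → Codes n → ℕ
    H p o V = c p o * g V + c′ p o * g′ p V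
    split : ∀ p o → sum (map (H p o) (allCodes n)) ≡ c p o * ∑Codes n g + c′ p o * ∑Codes n (g′ p)
    split p o = trans (sum-map-+ _ _ (allCodes n))
      (cong₂ _+_ (*-distribˡ-sum-map (c p o) g (allCodes n)) (*-distribˡ-sum-map (c′ p o) (g′ p) (allCodes n)))

  newInversions-cong : ∀ x {U U′} → (∀ r → r < k → U r ≡ U′ r) → newInversions x U ≡ newInversions x U′
  newInversions-cong x eq = ∑<-cong (k * m) (λ l l<km → cong (λ b → ind ((block x 0 <ᵇ suc l) ∧ b)) (eq (l / m) (m<n*o⇒m/o<n l<km)))

  weight-▹ : ∀ {n} (V : Codes n) x U b → (b ≡ true → UsesExactly (V ▹ x) U) →
             ind b * weight (V ▹ x) ≡ ind b * (q ^ newInversions x U * weight V)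
  weight-▹ V x U false _    = refl
  weight-▹ V x U true  exact = cong (1 *_) (begin
    q ^ invCodes (V ▹ x)                                      ≡⟨ cong (q ^_) (invCodes-▹ V x) ⟩
    q ^ (invCodes V + newInversions x (uses (V ▹ x)))
      ≡⟨ cong (λ z → q ^ (invCodes V + z)) (newInversions-cong x (exact refl)) ⟩
    q ^ (invCodes V + newInversions x U)                      ≡⟨ ^-distribˡ-+-* q (invCodes V) _ ⟩
    weight V * q ^ newInversions x U                          ≡⟨ *-comm (weight V) _ ⟩
    q ^ newInversions x U * weight V                          ∎)
    where open ≡-Reasoning

  after : ℕ → (ℕ → Bool) → ℕ
  after b U = ∑[ l < k * m ] ind ((b <ᵇ l) ∧ U (l / m))

  ∑<-blocks : ∀ U → ∑[ l < k * m ] ind (U (l / m)) ≡ size U * m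
  ∑<-blocks U = begin
    ∑[ l < k * m ] ind (U (l / m))                     ≡⟨ ∑<-* k m _ ⟩
    ∑[ p < k ] ∑[ o < m ] ind (U ((p * m + o) / m))
      ≡⟨ ∑<-cong k (λ p _ → ∑<-cong m (λ o o<m → cong (ind ∘ U) ([p*d+r]/d≡p p o<m))) ⟩
    ∑[ p < k ] ∑[ _ < m ] ind (U p)                    ≡⟨ ∑<-cong k (λ p _ → ∑<-const m (ind (U p))) ⟩
    ∑[ p < k ] m * ind (U p)                           ≡⟨ *-distribˡ-∑< k m _ ⟩
    m * size U                                         ≡⟨ *-comm m (size U) ⟩
    size U * m                                         ∎
    where open ≡-Reasoning

  newInversions-just : ∀ p o U → newInversions (just (p , o)) U ≡ after (toℕ p * m + toℕ o) U
  newInversions-just p o U = ∑<-cong (k * m) (λ l _ → cong (λ r → ind ((toℕ p * m + r <ᵇ l) ∧ U (l / m)))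
    (trans (cong (_% m) (+-identityʳ (toℕ o))) (m<n⇒m%n≡m (Fin.toℕ<n o))))

  ∑<-q^after : ∀ U → ∑[ p < k ] ∑[ o < m ] (ind (U p) * q ^ after (p * m + o) U) ≡ qint q (size U * m)
  ∑<-q^after U = begin
    ∑[ p < k ] ∑[ o < m ] (ind (U p) * q ^ after (p * m + o) U)
      ≡⟨ ∑<-cong k (λ p _ → ∑<-cong m (λ o o<m → cong (λ r → ind (U r) * q ^ after (p * m + o) U) (sym ([p*d+r]/d≡p p o<m)))) ⟩
    ∑[ p < k ] ∑[ o < m ] (ind (U ((p * m + o) / m)) * q ^ after (p * m + o) U)
      ≡⟨ sym (∑<-* k m (λ b → ind (U (b / m)) * q ^ after b U)) ⟩
    ∑[ b < k * m ] (ind (U (b / m)) * q ^ after b U)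
      ≡⟨ ∑<-q^marked-after q (k * m) (λ l → U (l / m)) ⟩
    qint q (∑[ l < k * m ] ind (U (l / m)))
      ≡⟨ cong (qint q) (∑<-blocks U) ⟩
    qint q (size U * m)
      ∎
    where open ≡-Reasoning

  past-orbit : ∀ p l → p * m + (m ∸ 1) < l → suc p ≤ l / m
  past-orbit p l lt = subst (_≤ l / m) (m*n/n≡m (suc p) m) (/-monoˡ-≤ m (subst (_≤ l) 1+p*m+[m∸1]≡[1+p]*m lt))
    where
    1+p*m+[m∸1]≡[1+p]*m : suc (p * m + (m ∸ 1)) ≡ suc p * m
    1+p*m+[m∸1]≡[1+p]*m = trans (sym (+-suc (p * m) (m ∸ 1))) (trans (cong (p * m +_) suc[d∸1]≡d) (+-comm (p * m) m))

  after-orbitEnd : ∀ p → after (p * m + (m ∸ 1)) (below (suc p)) ≡ 0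
  after-orbitEnd p = trans (∑<-cong (k * m) (λ l _ → term l)) (∑<-zero (k * m))
    where
    term : ∀ l → ind ((p * m + (m ∸ 1) <ᵇ l) ∧ below (suc p) (l / m)) ≡ 0
    term l with p * m + (m ∸ 1) <ᵇ l in lt
    ... | false = refl
    ... | true  rewrite reflects-false (<ᵇ-reflects-< (l / m) (suc p)) (≤⇒≯ (past-orbit p l (reflects-sound (<ᵇ-reflects-< _ l) lt))) = refl

  ind-*-cong : ∀ b {x y} → (b ≡ true → x ≡ y) → ind b * x ≡ ind b * y
  ind-*-cong false _  = refl
  ind-*-cong true  eq = cong (1 *_) (eq refl)

  weight-▹-nothing : ∀ {n} (V : Codes n) U b → (b ≡ true → UsesExactly (V ▹ nothing) U) →
                     ind b * weight (V ▹ nothing) ≡ q ^ (size U * m) * (ind b * weight V)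
  weight-▹-nothing V U b exact = begin
    ind b * weight (V ▹ nothing)              ≡⟨ weight-▹ V nothing U b exact ⟩
    ind b * (q ^ newInversions nothing U * weight V) ≡⟨ cong (λ z → ind b * (q ^ z * weight V)) (∑<-blocks U) ⟩
    ind b * (q ^ (size U * m) * weight V)
      ≡⟨ solve 3 (λ x a w → x :* (a :* w) := a :* (x :* w)) refl (ind b) (q ^ (size U * m)) (weight V) ⟩
    q ^ (size U * m) * (ind b * weight V)     ∎
    where open ≡-Reasoning

  crSummand : ∀ {n} → (ℕ → Bool) → Codes n → ℕ
  crSummand U V = ind (usesExactlyᵇ U V) * weight V

  crSum : (ℕ → Bool) → ℕ → ℕ
  crSum U n = ∑Codes n (crSummand U)

  crCoefficient : (ℕ → Bool) → ℕ → ℕ → ℕ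
  crCoefficient U p o = ind (U p) * q ^ after (p * m + o) U

  crSummand-▹-just : ∀ {n} U (V : Codes n) p o → let c = crCoefficient U (toℕ p) (toℕ o) in
                     crSummand U (V ▹ just (p , o)) ≡ c * crSummand U V + c * crSummand (U ∖ toℕ p) V
  crSummand-▹-just U V p o = begin
    ind (U P ∧ (old ∨ new)) * weight (V ▹ x)
      ≡⟨ weight-▹ V x U _ (usesExactlyᵇ-sound U (V ▹ x)) ⟩
    ind (U P ∧ (old ∨ new)) * (q ^ newInversions x U * weight V)
      ≡⟨ cong₂ (λ a z → a * (q ^ z * weight V)) (trans (ind-∧ (U P) _) (ind-*-cong (U P) disjoint)) (newInversions-just p o U) ⟩
    ind (U P) * (ind old + ind new) * (a * weight V)
      ≡⟨ solve 5 (λ u x y a w → u :* (x :+ y) :* (a :* w) := (u :* a) :* (x :* w) :+ (u :* a) :* (y :* w)) refl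
               (ind (U P)) (ind old) (ind new) a (weight V) ⟩
    crCoefficient U P (toℕ o) * crSummand U V + crCoefficient U P (toℕ o) * crSummand (U ∖ P) V
      ∎
    where
    open ≡-Reasoning
    P = toℕ p
    x = just (p , o)
    a = q ^ after (P * m + toℕ o) U
    old = usesExactlyᵇ U V
    new = usesExactlyᵇ (U ∖ P) V
    disjoint : U P ≡ true → ind (old ∨ new) ≡ ind old + ind new
    disjoint UP = ind-∨ old new (usesExactlyᵇ-exclusive U V P (Fin.toℕ<n p) UP)

  crSum-suc : ∀ U n → crSum U (suc n) ≡ q ^ (size U * m) * crSum U n
    + (∑[ p < k ] ∑[ o < m ] (crCoefficient U p o * crSum U n + crCoefficient U p o * crSum (U ∖ p) n))
  crSum-suc U n = ∑Codes-▹ n (crSummand U) (crSummand U) (λ p → crSummand (U ∖ p)) (q ^ (size U * m))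
    (crCoefficient U) (crCoefficient U)
    (λ V → weight-▹-nothing V U (usesExactlyᵇ U V) (usesExactlyᵇ-sound U (V ▹ nothing))) (crSummand-▹-just U)

  stdSummand : ∀ {n} → ℕ → Codes n → ℕ
  stdSummand j V = ind (standardᵇ j V) * weight V

  stdSum : ℕ → ℕ → ℕ
  stdSum j n = ∑Codes n (stdSummand j)

  joinCoefficient openCoefficient : ℕ → ℕ → ℕ → ℕ
  joinCoefficient j p o = ind (p <ᵇ j) * q ^ after (p * m + o) (below j)
  openCoefficient j p o = ind (suc p ≡ᵇ j) * ind (o ≡ᵇ m ∸ 1)

  stdSummand-▹-just : ∀ {n} j (V : Codes n) p o → stdSummand j (V ▹ just (p , o))
    ≡ joinCoefficient j (toℕ p) (toℕ o) * stdSummand j V + openCoefficient j (toℕ p) (toℕ o) * stdSummand (toℕ p) V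
  stdSummand-▹-just j V p o = begin
    ind (joins ∨ opens) * weight (V ▹ x)
      ≡⟨ weight-▹ V x (below j) _ (standardᵇ-exact j (V ▹ x)) ⟩
    ind (joins ∨ opens) * (q ^ newInversions x (below j) * weight V)
      ≡⟨ cong₂ (λ b z → b * (q ^ z * weight V)) (ind-∨ joins opens exclusive) (newInversions-just p o (below j)) ⟩
    (ind joins + ind opens) * (a * weight V)
      ≡⟨ *-distribʳ-+ (a * weight V) (ind joins) (ind opens) ⟩
    ind joins * (a * weight V) + ind opens * (a * weight V)
      ≡⟨ cong₂ _+_ (cong (_* (a * weight V)) (ind-∧ (P <ᵇ j) (standardᵇ j V)))
                   (trans (ind-*-cong opens (λ op → cong (_* weight V) (a≡1 op)))
                          (cong (_* (1 * weight V)) (trans (ind-∧ (suc P ≡ᵇ j) _)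
                                                           (cong (ind (suc P ≡ᵇ j) *_) (ind-∧ (O ≡ᵇ m ∸ 1) _))))) ⟩
    ind (P <ᵇ j) * ind (standardᵇ j V) * (a * weight V)
      + ind (suc P ≡ᵇ j) * (ind (O ≡ᵇ m ∸ 1) * ind (standardᵇ P V)) * (1 * weight V)
      ≡⟨ solve 7 (λ x s a w y z t → x :* s :* (a :* w) :+ y :* (z :* t) :* (con 1 :* w)
                                 := (x :* a) :* (s :* w) :+ (y :* z) :* (t :* w)) refl
               (ind (P <ᵇ j)) (ind (standardᵇ j V)) a (weight V)
               (ind (suc P ≡ᵇ j)) (ind (O ≡ᵇ m ∸ 1)) (ind (standardᵇ P V)) ⟩
    joinCoefficient j P O * stdSummand j V + openCoefficient j P O * stdSummand P V
      ∎
    where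
    open ≡-Reasoning
    P = toℕ p
    O = toℕ o
    x = just (p , o)
    a = q ^ after (P * m + O) (below j)
    joins = (P <ᵇ j) ∧ standardᵇ j V
    opens = (suc P ≡ᵇ j) ∧ (O ≡ᵇ m ∸ 1) ∧ standardᵇ P V
    exclusive : joins ≡ true → opens ≡ false
    exclusive jn with opens in op
    ... | false = refl
    ... | true with ∧-true {suc P ≡ᵇ j} op
    ...   | j≡ , rest = clash (proj₂ (∧-true {O ≡ᵇ m ∸ 1} rest)) (standardᵇ-exclusive P V
                          (subst (λ i → standardᵇ i V ≡ true) (sym (reflects-sound (≡ᵇ-reflects-≡ (suc P) j) j≡))
                                 (proj₂ (∧-true {P <ᵇ j} jn))))
    a≡1 : opens ≡ true → a ≡ 1
    a≡1 op with ∧-true {suc P ≡ᵇ j} op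
    ... | j≡ , rest = cong (q ^_) (trans
      (cong₂ (λ r i → after (P * m + r) (below i))
             (reflects-sound (≡ᵇ-reflects-≡ O (m ∸ 1)) (proj₁ (∧-true {O ≡ᵇ m ∸ 1} rest)))
             (sym (reflects-sound (≡ᵇ-reflects-≡ (suc P) j) j≡)))
      (after-orbitEnd P))

  stdSum-suc : ∀ j n → stdSum j (suc n) ≡ q ^ (size (below j) * m) * stdSum j n
    + (∑[ p < k ] ∑[ o < m ] (joinCoefficient j p o * stdSum j n + openCoefficient j p o * stdSum p n))
  stdSum-suc j n = ∑Codes-▹ n (stdSummand j) (stdSummand j) stdSummand (q ^ (size (below j) * m))
    (joinCoefficient j) (openCoefficient j)
    (λ V → weight-▹-nothing V (below j) (standardᵇ j V) (standardᵇ-exact j (V ▹ nothing))) (stdSummand-▹-just j)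

  ∑<-joinCoefficient : ∀ j → j ≤ k → ∑[ p < k ] ∑[ o < m ] joinCoefficient j p o ≡ qint q (j * m)
  ∑<-joinCoefficient j j≤k = trans (∑<-q^after (below j)) (cong (λ s → qint q (s * m)) (size-below j≤k))

  ∑<-openCoefficient : ∀ j → j < k → (g : ℕ → ℕ) → ∑[ p < k ] ∑[ o < m ] (openCoefficient (suc j) p o * g p) ≡ g j
  ∑<-openCoefficient j j<k g = begin
    ∑[ p < k ] ∑[ o < m ] (ind (p ≡ᵇ j) * ind (o ≡ᵇ m ∸ 1) * g p)
      ≡⟨ ∑<-cong k (λ p _ → trans (∑<-cong m (λ o _ → *-assoc (ind (p ≡ᵇ j)) _ _)) (*-distribˡ-∑< m (ind (p ≡ᵇ j)) _)) ⟩
    ∑[ p < k ] (ind (p ≡ᵇ j) * (∑[ o < m ] (ind (o ≡ᵇ m ∸ 1) * g p)))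
      ≡⟨ ∑<-select k j _ j<k ⟩
    ∑[ o < m ] (ind (o ≡ᵇ m ∸ 1) * g j)
      ≡⟨ ∑<-select m (m ∸ 1) _ (subst (m ∸ 1 <_) suc[d∸1]≡d ≤-refl) ⟩
    g j
      ∎
    where open ≡-Reasoning

  stirling : ℕ → ℕ → ℕ
  stirling zero    zero    = 1
  stirling zero    (suc j) = 0
  stirling (suc n) zero    = stirling n zero
  stirling (suc n) (suc j) = qint q (suc (suc j * m)) * stirling n (suc j) + stirling n j

  stirling-suc : ∀ n j → stirling (suc n) (suc j)
               ≡ q ^ (suc j * m) * stirling n (suc j) + (qint q (suc j * m) * stirling n (suc j) + stirling n j)
  stirling-suc n j = begin
    qint q (suc (suc j * m)) * s₁ + s₀         ≡⟨ cong (λ z → z * s₁ + s₀) (qint-suc q (suc j * m)) ⟩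
    (qint q (suc j * m) + q ^ (suc j * m)) * s₁ + s₀
      ≡⟨ solve 4 (λ b a s₁ s₀ → (b :+ a) :* s₁ :+ s₀ := a :* s₁ :+ (b :* s₁ :+ s₀)) refl
                 (qint q (suc j * m)) (q ^ (suc j * m)) s₁ s₀ ⟩
    q ^ (suc j * m) * s₁ + (qint q (suc j * m) * s₁ + s₀) ∎
    where
    open ≡-Reasoning
    s₁ = stirling n (suc j)
    s₀ = stirling n j

  stdSum-closed : ∀ n j → j ≤ k → stdSum j n ≡ stirling n j
  stdSum-closed zero    zero    _   = refl
  stdSum-closed zero    (suc j) _   = refl
  stdSum-closed (suc n) zero    _   = begin
    stdSum 0 (suc n)
      ≡⟨ stdSum-suc 0 n ⟩
    q ^ (size (below 0) * m) * stdSum 0 n + (∑[ p < k ] ∑[ o < m ] 0)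
      ≡⟨ cong₂ (λ s z → q ^ (s * m) * stdSum 0 n + z)
               (size-below z≤n) (trans (∑<-cong k (λ _ _ → ∑<-zero m)) (∑<-zero k)) ⟩
    1 * stdSum 0 n + 0
      ≡⟨ trans (+-identityʳ _) (*-identityˡ _) ⟩
    stdSum 0 n
      ≡⟨ stdSum-closed n 0 z≤n ⟩
    stirling (suc n) 0
      ∎
    where open ≡-Reasoning
  stdSum-closed (suc n) (suc j) j<k = begin
    stdSum (suc j) (suc n)
      ≡⟨ stdSum-suc (suc j) n ⟩
    q ^ (size (below (suc j)) * m) * Sⱼ + (∑[ p < k ] ∑[ o < m ] (c p o * Sⱼ + c′ p o * stdSum p n))
      ≡⟨ cong₂ (λ s z → q ^ (s * m) * Sⱼ + z) (size-below j<k) split ⟩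
    q ^ (suc j * m) * Sⱼ + (qint q (suc j * m) * Sⱼ + stdSum j n)
      ≡⟨ cong₂ (λ z y → q ^ (suc j * m) * z + (qint q (suc j * m) * z + y))
               (stdSum-closed n (suc j) j<k) (stdSum-closed n j (<⇒≤ j<k)) ⟩
    q ^ (suc j * m) * stirling n (suc j) + (qint q (suc j * m) * stirling n (suc j) + stirling n j)
      ≡⟨ sym (stirling-suc n j) ⟩
    stirling (suc n) (suc j)
      ∎
    where
    open ≡-Reasoning
    Sⱼ = stdSum (suc j) n
    c = joinCoefficient (suc j)
    c′ = openCoefficient (suc j)
    split : ∑[ p < k ] ∑[ o < m ] (c p o * Sⱼ + c′ p o * stdSum p n) ≡ qint q (suc j * m) * Sⱼ + stdSum j n
    split = begin
      ∑[ p < k ] ∑[ o < m ] (c p o * Sⱼ + c′ p o * stdSum p n)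
        ≡⟨ trans (∑<-cong k (λ p _ → ∑<-distrib-+ m _ _)) (∑<-distrib-+ k _ _) ⟩
      (∑[ p < k ] ∑[ o < m ] c p o * Sⱼ) + (∑[ p < k ] ∑[ o < m ] c′ p o * stdSum p n)
        ≡⟨ cong (_+ (∑[ p < k ] ∑[ o < m ] c′ p o * stdSum p n))
                (trans (∑<-cong k (λ p _ → *-distribʳ-∑< m Sⱼ (c p))) (*-distribʳ-∑< k Sⱼ (λ p → ∑< m (c p)))) ⟩
      (∑[ p < k ] ∑[ o < m ] c p o) * Sⱼ + (∑[ p < k ] ∑[ o < m ] c′ p o * stdSum p n)
        ≡⟨ cong₂ (λ x y → x * Sⱼ + y) (∑<-joinCoefficient (suc j) j<k) (∑<-openCoefficient j j<k (λ p → stdSum p n)) ⟩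
      qint q (suc j * m) * Sⱼ + stdSum j n
        ∎

  crSum-closed-step : ∀ n s →
    q ^ (s * m) * (qfactm q m s * stirling n s)
      + qint q (s * m) * (qfactm q m s * stirling n s + qfactm q m (pred s) * stirling n (pred s))
    ≡ qfactm q m s * stirling (suc n) s
  crSum-closed-step n zero    = trans (+-identityʳ _) (*-identityˡ _)
  crSum-closed-step n (suc j) = begin
    a * (qfactm q m (suc j) * s₁) + b * (qfactm q m (suc j) * s₁ + f * s₀)
      ≡⟨ cong (λ F → a * (F * s₁) + b * (F * s₁ + f * s₀)) (qfactm-suc q m j) ⟩
    a * ((f * b) * s₁) + b * ((f * b) * s₁ + f * s₀)
      ≡⟨ solve 5 (λ a b f s₁ s₀ → a :* ((f :* b) :* s₁) :+ b :* ((f :* b) :* s₁ :+ f :* s₀)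
                                := (f :* b) :* (a :* s₁ :+ (b :* s₁ :+ s₀))) refl a b f s₁ s₀ ⟩
    (f * b) * (a * s₁ + (b * s₁ + s₀))
      ≡⟨ cong₂ _*_ (sym (qfactm-suc q m j)) (sym (stirling-suc n j)) ⟩
    qfactm q m (suc j) * stirling (suc n) (suc j)
      ∎
    where
    open ≡-Reasoning
    a = q ^ (suc j * m)
    b = qint q (suc j * m)
    f = qfactm q m j
    s₁ = stirling n (suc j)
    s₀ = stirling n j

  crSum-closed : ∀ n U → crSum U n ≡ qfactm q m (size U) * stirling n (size U)
  crSum-closed zero U with size U
  ... | zero  = refl
  ... | suc s = sym (*-zeroʳ (qfactm q m (suc s)))
  crSum-closed (suc n) U = begin
    crSum U (suc n)
      ≡⟨ crSum-suc U n ⟩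
    q ^ (s * m) * crSum U n + (∑[ p < k ] ∑[ o < m ] (c p o * crSum U n + c p o * crSum (U ∖ p) n))
      ≡⟨ cong (q ^ (s * m) * crSum U n +_) (∑<-cong k (λ p p<k → ∑<-cong m (λ o _ → removed p p<k o))) ⟩
    q ^ (s * m) * crSum U n + (∑[ p < k ] ∑[ o < m ] (c p o * Y))
      ≡⟨ cong (q ^ (s * m) * crSum U n +_) (trans (∑<-cong k (λ p _ → *-distribʳ-∑< m Y (c p)))
           (trans (*-distribʳ-∑< k Y (λ p → ∑< m (c p))) (cong (_* Y) (∑<-q^after U)))) ⟩
    q ^ (s * m) * crSum U n + qint q (s * m) * Y
      ≡⟨ cong (λ z → q ^ (s * m) * z + qint q (s * m) * (z + D)) (crSum-closed n U) ⟩
    q ^ (s * m) * (qfactm q m s * stirling n s) + qint q (s * m) * (qfactm q m s * stirling n s + D)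
      ≡⟨ crSum-closed-step n s ⟩
    qfactm q m s * stirling (suc n) s
      ∎
    where
    open ≡-Reasoning
    s = size U
    c = crCoefficient U
    D = qfactm q m (pred s) * stirling n (pred s)
    Y = crSum U n + D
    removed : ∀ p → p < k → ∀ o → c p o * crSum U n + c p o * crSum (U ∖ p) n ≡ c p o * Y
    removed p p<k o with U p in Up
    ... | false = refl
    ... | true rewrite crSum-closed n (U ∖ p) | size-∖ U p p<k Up = sym (*-distribˡ-+ (1 * q ^ after (p * m + o) U) _ _)

module Decoding (m k : ℕ) .{{_ : NonZero m}} where
  open ModArith m
  open Encoding m k
  open Equivalence using (to; from)

  module _ {n} (f : Label m n k) where

    minb-rotate : ∀ t j j′ → RotBlock m n k f t j j′ → minb m n k f j ≡ minb m n k f j′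
    minb-rotate t j j′ rot = foldr-cong (λ i acc → cong (λ b → if b then toℕ i else acc) (occurs⇔ i)) refl (allFin n)
      where
      occurs⇔ : ∀ i → any (λ c → lab m n k f i c ≡ᵇ j) (allFin m) ≡ any (λ c → lab m n k f i c ≡ᵇ j′) (allFin m)
      occurs⇔ i = ⇔→≡ (mk⇔ forward backward)
        where
        forward : any (λ c → lab m n k f i c ≡ᵇ j) (allFin m) ≡ true → any (λ c → lab m n k f i c ≡ᵇ j′) (allFin m) ≡ true
        forward e with any-true⁻ _ (allFin m) e
        ... | c , ec = any-true _ (allFin m) (∈-allFin (rotate t c)) (reflects-complete (≡ᵇ-reflects-≡ _ _)
                         (to (rot i c (rotate t c) (toℕ-rotate t c)) (reflects-sound (≡ᵇ-reflects-≡ _ _) ec)))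
        backward : any (λ c → lab m n k f i c ≡ᵇ j′) (allFin m) ≡ true → any (λ c → lab m n k f i c ≡ᵇ j) (allFin m) ≡ true
        backward e with any-true⁻ _ (allFin m) e
        ... | c′ , ec′ = any-true _ (allFin m) (∈-allFin c) (reflects-complete (≡ᵇ-reflects-≡ _ _)
                           (from (rot i c c′ (rotate-inverse t c′)) (reflects-sound (≡ᵇ-reflects-≡ _ _) ec′)))
          where c = rotate (m ∸ t % m) c′

    Rotational : Set
    Rotational = ∀ l → l < k → ∀ u → u < m → RotBlock m n k f u (l * m + 1) (l * m + 1 + u)

    rotational-lab : Rotational → ∀ i j → lab m n k f i colour₀ ≡ suc j → j < k * m →
                     ∀ c → lab m n k f i c ≡ suc (j / m * m + (j % m + toℕ c) % m)
    -- With p = j / m and w = j mod m, the element i^c₁ lies in the first block S_(pm+1) of the orbit,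
    -- and rotating it by u = (w + c) mod m reaches i^c.
    rotational-lab rot i j e j<km c = begin
      lab m n k f i c                  ≡⟨ to (rot p p<k u u<m i c₁ c c≡) lab-c₁ ⟩
      p * m + 1 + u                    ≡⟨ cong (_+ u) (+-comm (p * m) 1) ⟩
      suc (p * m + u)                  ∎
      where
      open ≡-Reasoning
      p = j / m
      w = j % m
      p<k : p < k
      p<k = m<n*o⇒m/o<n j<km
      w<m : w < m
      w<m = m%n<n j m
      u = (w + toℕ c) % m
      u<m : u < m
      u<m = m%n<n (w + toℕ c) m
      c₁ = rotate (m ∸ w % m) colour₀
      lab-c₁ : lab m n k f i c₁ ≡ p * m + 1
      lab-c₁ = from (rot p p<k w w<m i c₁ colour₀ (rotate-inverse w colour₀))
        (trans e (trans (cong suc (m≡[m/d]*d+m%d j)) (cong (_+ w) (+-comm 1 (p * m)))))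
      c≡ : toℕ c ≡ (toℕ c₁ + u) % m
      c≡ = sym (begin
        (toℕ c₁ + u) % m                   ≡⟨ [m+n%d]%d≡[m+n]%d (toℕ c₁) (w + toℕ c) ⟩
        (toℕ c₁ + (w + toℕ c)) % m         ≡⟨ cong (_% m) (sym (+-assoc (toℕ c₁) w (toℕ c))) ⟩
        (toℕ c₁ + w + toℕ c) % m           ≡⟨ sym ([m%d+n]%d≡[m+n]%d (toℕ c₁ + w) (toℕ c)) ⟩
        ((toℕ c₁ + w) % m + toℕ c) % m
          ≡⟨ cong (λ z → (z + toℕ c) % m) (trans (sym (rotate-inverse w colour₀)) (Fin.toℕ-fromℕ< _)) ⟩
        (0 + toℕ c) % m                    ≡⟨ m<n⇒m%n≡m (Fin.toℕ<n c) ⟩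
        toℕ c                              ∎)

  codeOfBlock : ℕ → Code
  codeOfBlock zero    = nothing
  codeOfBlock (suc j) with j <? k * m
  ... | yes j<km = just (fromℕ< (m<n*o⇒m/o<n j<km) , fromℕ< (m%n<n j m))
  ... | no  _    = nothing

  module _ {n} (f : Label m n k) where

    lab≡block-codeOfBlock : (∀ i c d → lab m n k f i c ≡ 0 → lab m n k f i d ≡ 0) → Rotational f →
                            ∀ i c → lab m n k f i c ≡ block (codeOfBlock (lab m n k f i colour₀)) (toℕ c)
    lab≡block-codeOfBlock zeroBlock rot i c with lab m n k f i colour₀ in e | Fin.toℕ<n (lookup (lookup f i) colour₀)
    ... | zero  | _ = zeroBlock i colour₀ c e
    ... | suc j | j<1+km with j <? k * m
    ...   | yes j<km = trans (rotational-lab f rot i j e j<km c) (cong suc (cong₂ (λ a b → a * m + (b + toℕ c) % m)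
                          (sym (Fin.toℕ-fromℕ< (m<n*o⇒m/o<n j<km))) (sym (Fin.toℕ-fromℕ< (m%n<n j m)))))
    ...   | no  j≮km = ⊥-elim (j≮km (s<s⁻¹ j<1+km))

  tabulateCodes : ∀ n → (ℕ → Code) → Codes n
  tabulateCodes zero    g = []
  tabulateCodes (suc n) g = tabulateCodes n g ▹ g n

  codeAt-tabulateCodes : ∀ n g i → i < n → codeAt (tabulateCodes n g) i ≡ g i
  codeAt-tabulateCodes (suc n) g i i<1+n with m<1+n⇒m<n∨m≡n i<1+n
  ... | inj₁ i<n  = trans (codeAt-▹-< (tabulateCodes n g) (g n) i<n) (codeAt-tabulateCodes n g i i<n)
  ... | inj₂ refl = codeAt-▹-last (tabulateCodes n g) (g n)

  label-ext : ∀ {n} (f f′ : Label m n k) → (∀ i c → lab m n k f i c ≡ lab m n k f′ i c) → f ≡ f′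
  label-ext f f′ eq = vec-ext f f′ (λ i → vec-ext _ _ (λ c → Fin.toℕ-injective (eq i c)))

  decode : ∀ {n} (f : Label m n k) → (∀ i c d → lab m n k f i c ≡ 0 → lab m n k f i d ≡ 0) → Rotational f →
           ∃[ V ] f ≡ encode V
  decode {n} f zeroBlock rot = V , label-ext f (encode V) λ i c → begin
    lab m n k f i c                                        ≡⟨ lab≡block-codeOfBlock f zeroBlock rot i c ⟩
    block (codeOfBlock (lab m n k f i colour₀)) (toℕ c)    ≡⟨ cong (λ x → block x (toℕ c)) (sym (baseCode-toℕ i)) ⟩
    block (baseCode (toℕ i)) (toℕ c)
      ≡⟨ cong (λ x → block x (toℕ c)) (sym (codeAt-tabulateCodes n baseCode (toℕ i) (Fin.toℕ<n i))) ⟩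
    block (codeAt V (toℕ i)) (toℕ c)                       ≡⟨ sym (lab-encode V i c) ⟩
    lab m n k (encode V) i c                               ∎
    where
    open ≡-Reasoning
    baseCode : ℕ → Code
    baseCode i with i <? n
    ... | yes i<n = codeOfBlock (lab m n k f (fromℕ< i<n) colour₀)
    ... | no  _   = nothing
    baseCode-toℕ : ∀ i → baseCode (toℕ i) ≡ codeOfBlock (lab m n k f i colour₀)
    baseCode-toℕ i with toℕ i <? n
    ... | yes i<n = cong (λ i′ → codeOfBlock (lab m n k f i′ colour₀)) (Fin.fromℕ<-toℕ i i<n)
    ... | no  i≮n = ⊥-elim (i≮n (Fin.toℕ<n i))
    V = tabulateCodes n baseCode

module EncodedPartitions (m k : ℕ) .{{_ : NonZero m}} where
  open ModArith m
  open Encoding m k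
  open OrbitSets m k
  open Decoding m k

  block-rotate : ∀ x l u u′ t → u < m → u′ < m → (u + t) % m ≡ u′ → ∀ c c′ → c′ ≡ (c + t) % m →
                 block x c ≡ suc (l * m + u) ⇔ block x c′ ≡ suc (l * m + u′)
  block-rotate nothing        l u u′ t u<m u′<m u+t c c′ c′≡ = mk⇔ (λ ()) (λ ())
  block-rotate (just (p , o)) l u u′ t u<m u′<m u+t c c′ c′≡ = mk⇔ forward backward
    where
    forward : block (just (p , o)) c ≡ suc (l * m + u) → block (just (p , o)) c′ ≡ suc (l * m + u′)
    forward eq with divMod-unique (toℕ p) l (m%n<n (toℕ o + c) m) u<m (suc-injective eq)
    ... | p≡l , r≡u = cong suc (cong₂ (λ a b → a * m + b) p≡l (begin
      (toℕ o + c′) % m            ≡⟨ cong (λ z → (toℕ o + z) % m) c′≡ ⟩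
      (toℕ o + (c + t) % m) % m   ≡⟨ [m+[n+o]%d]%d≡[[m+n]%d+o]%d (toℕ o) c t ⟩
      ((toℕ o + c) % m + t) % m   ≡⟨ cong (λ z → (z + t) % m) r≡u ⟩
      (u + t) % m                 ≡⟨ u+t ⟩
      u′                          ∎))
      where open ≡-Reasoning
    backward : block (just (p , o)) c′ ≡ suc (l * m + u′) → block (just (p , o)) c ≡ suc (l * m + u)
    backward eq with divMod-unique (toℕ p) l (m%n<n (toℕ o + c′) m) u′<m (suc-injective eq)
    ... | p≡l , r≡u′ = cong suc (cong₂ (λ a b → a * m + b) p≡l (+-%-injectiveˡ t (m%n<n (toℕ o + c) m) u<m (begin
      ((toℕ o + c) % m + t) % m   ≡⟨ sym ([m+[n+o]%d]%d≡[[m+n]%d+o]%d (toℕ o) c t) ⟩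
      (toℕ o + (c + t) % m) % m   ≡⟨ cong (λ z → (toℕ o + z) % m) (sym c′≡) ⟩
      (toℕ o + c′) % m            ≡⟨ r≡u′ ⟩
      u′                          ≡⟨ sym u+t ⟩
      (u + t) % m                 ∎)))
      where open ≡-Reasoning

  module _ {n} (V : Codes n) where

    encode-rotate : ∀ l u u′ t → u < m → u′ < m → (u + t) % m ≡ u′ →
                    RotBlock m n k (encode V) t (suc (l * m + u)) (suc (l * m + u′))
    encode-rotate l u u′ t u<m u′<m u+t i c c′ c′≡ = mk⇔
      (λ e → trans (lab-encode V i c′) (Equivalence.to rot (trans (sym (lab-encode V i c)) e)))
      (λ e → trans (lab-encode V i c) (Equivalence.from rot (trans (sym (lab-encode V i c′)) e)))
      where
      rot : block (codeAt V (toℕ i)) (toℕ c) ≡ suc (l * m + u) ⇔ block (codeAt V (toℕ i)) (toℕ c′) ≡ suc (l * m + u′)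
      rot = block-rotate (codeAt V (toℕ i)) l u u′ t u<m u′<m u+t (toℕ c) (toℕ c′) c′≡

    encode-rotational : Rotational (encode V)
    encode-rotational l _ u u<m = subst₂ (RotBlock m n k (encode V) u) (trans (cong suc (+-identityʳ (l * m))) (+-comm 1 (l * m)))
      (cong (_+ u) (+-comm 1 (l * m)))
      (encode-rotate l 0 u u (>-nonZero⁻¹ m) u<m (m<n⇒m%n≡m u<m))

    encode-zeroBlock : ∀ i c d → lab m n k (encode V) i c ≡ 0 → lab m n k (encode V) i d ≡ 0
    encode-zeroBlock i c d e with codeAt V (toℕ i) in x | trans (sym (lab-encode V i c)) e
    ... | nothing | _ = trans (lab-encode V i d) (cong (λ y → block y (toℕ d)) x)

    encode-nonempty : UsesExactly V (below k) → ∀ j → 1 ≤ j → j ≤ k * m → ∃[ i ] ∃[ c ] lab m n k (encode V) i c ≡ j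
    encode-nonempty exact (suc j) _ j<km = fromℕ< (leader<n V r used) , c ,
      trans (lab-encode V _ c) (trans (cong (λ i → block (codeAt V i) (toℕ c)) (Fin.toℕ-fromℕ< _)) (proj₂ found))
      where
      r = j / m
      used : uses V r ≡ true
      used = trans (exact r (m<n*o⇒m/o<n j<km)) (reflects-complete (<ᵇ-reflects-< r k) (m<n*o⇒m/o<n j<km))
      found : Σ[ c ∈ Fin m ] block (codeAt V (leader V r)) (toℕ c) ≡ suc j
      found = inOrbit⇒block≡1+ (codeAt V (leader V r)) j (leader-inOrbit V r used)
      c = proj₁ found

    encode-nonempty⁻ : (∀ j → 1 ≤ j → j ≤ k * m → ∃[ i ] ∃[ c ] lab m n k (encode V) i c ≡ j) → UsesExactly V (below k)
    encode-nonempty⁻ nonempty r r<k with nonempty (suc (r * m + 0)) (s≤s z≤n) (p*m+r<k*m r<k (>-nonZero⁻¹ m))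
    ... | i , c , e = trans
      (uses-intro V r (toℕ i) (Fin.toℕ<n i)
        (subst (λ z → inOrbit (codeAt V (toℕ i)) z ≡ true) ([p*d+r]/d≡p r (>-nonZero⁻¹ m))
          (block≡1+⇒inOrbit (codeAt V (toℕ i)) (toℕ c) (r * m + 0) (trans (sym (lab-encode V i c)) e))))
      (sym (reflects-complete (<ᵇ-reflects-< r k) r<k))

    encode-partition : UsesExactly V (below k) → IsColoredPartition m n k (encode V)
    encode-partition exact = record
      { nonempty  = encode-nonempty exact
      ; zeroBlock = encode-zeroBlock
      ; orbits    = λ l l<k u u<m → u , u<m , encode-rotational l l<k u u<m
      }

    encode-cr : ∀ j → 1 ≤ j → j < k * m → ¬ (m ∣ j) → RotBlock m n k (encode V) 1 j (suc j)
    encode-cr (suc j) _ _ m∤1+j = subst₂ (RotBlock m n k (encode V) 1)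
      (cong suc (sym (m≡[m/d]*d+m%d j))) (cong suc (trans (+-suc _ u) (cong suc (sym (m≡[m/d]*d+m%d j)))))
      (encode-rotate (j / m) u (suc u) 1 (m%n<n j m) 1+u<m (trans (cong (_% m) (+-comm u 1)) (m<n⇒m%n≡m 1+u<m)))
      where
      u = j % m
      1+u<m : suc u < m
      1+u<m with m≤n⇒m<n∨m≡n (m%n<n j m)
      ... | inj₁ 1+u<m = 1+u<m
      ... | inj₂ 1+u≡m = ⊥-elim (m∤1+j (m%n≡0⇒n∣m (suc j) m (begin
        suc j % m                    ≡⟨ cong (λ z → suc z % m) (m≡[m/d]*d+m%d j) ⟩
        suc (j / m * m + u) % m      ≡⟨ cong (_% m) (sym (+-suc (j / m * m) u)) ⟩
        (j / m * m + suc u) % m      ≡⟨ cong (λ z → (j / m * m + z) % m) 1+u≡m ⟩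
        (j / m * m + m) % m          ≡⟨ cong (_% m) (+-comm (j / m * m) m) ⟩
        (suc (j / m) * m) % m        ≡⟨ m*n%n≡0 (suc (j / m)) m ⟩
        0                            ∎)))
        where open ≡-Reasoning

    encode-crOrdered : UsesExactly V (below k) → IsCROrdered m n k (encode V)
    encode-crOrdered exact = record { partition = encode-partition exact ; cr = encode-cr }

  module _ {n} (f : Label m n k) where

    rotate-compose : ∀ u j j′ j″ → RotBlock m n k f u j j′ → RotBlock m n k f 1 j′ j″ → RotBlock m n k f (suc u) j j″
    rotate-compose u j j′ j″ r₁ r₂ i c c″ c″≡ = mk⇔ (to step₂ ∘ to step₁) (from step₁ ∘ from step₂)
      where
      open Equivalence using (to; from)
      c′ = rotate u c
      step₁ : lab m n k f i c ≡ j ⇔ lab m n k f i c′ ≡ j′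
      step₁ = r₁ i c c′ (toℕ-rotate u c)
      step₂ : lab m n k f i c′ ≡ j′ ⇔ lab m n k f i c″ ≡ j″
      step₂ = r₂ i c′ c″ (begin
        toℕ c″                       ≡⟨ c″≡ ⟩
        (toℕ c + suc u) % m          ≡⟨ cong (_% m) (trans (+-suc (toℕ c) u) (sym (+-comm (toℕ c + u) 1))) ⟩
        (toℕ c + u + 1) % m          ≡⟨ sym ([m%d+n]%d≡[m+n]%d (toℕ c + u) 1) ⟩
        ((toℕ c + u) % m + 1) % m    ≡⟨ cong (λ z → (z + 1) % m) (sym (toℕ-rotate u c)) ⟩
        (toℕ c′ + 1) % m             ∎)
        where open ≡-Reasoning

    crOrdered-rotational : IsCROrdered m n k f → Rotational f
    crOrdered-rotational cro l l<k = go
      where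
      b = l * m + 1
      go : ∀ u → u < m → RotBlock m n k f u b (b + u)
      go zero    _     i c c′ c′≡
        rewrite +-identityʳ b
              | Fin.toℕ-injective {i = c′} {j = c} (trans c′≡ (trans (cong (_% m) (+-identityʳ (toℕ c))) (m<n⇒m%n≡m (Fin.toℕ<n c))))
              = mk⇔ id id
      go (suc u) 1+u<m = subst (RotBlock m n k f (suc u) b) (sym (+-suc b u))
        (rotate-compose u b (b + u) (suc (b + u)) (go u (<⇒≤ 1+u<m))
          (IsCROrdered.cr cro (b + u) 1≤b+u b+u<km m∤b+u))
        where
        1≤b+u : 1 ≤ b + u
        1≤b+u = subst (1 ≤_) (trans (sym (+-suc (l * m) u)) (sym (+-assoc (l * m) 1 u))) (s≤s z≤n)
        b+u<km : b + u < k * m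
        b+u<km = subst (_< k * m) (sym (+-assoc (l * m) 1 u)) (p*m+r<k*m l<k 1+u<m)
        m∤b+u : ¬ (m ∣ b + u)
        m∤b+u m∣ = 0≢1+n (trans (sym (n∣m⇒m%n≡0 _ m m∣)) (begin
          (b + u) % m           ≡⟨ cong (_% m) (+-assoc (l * m) 1 u) ⟩
          (l * m + suc u) % m   ≡⟨ [p*d+r]%d≡r l 1+u<m ⟩
          suc u                 ∎))
          where open ≡-Reasoning

  crOrdered⇒encode : ∀ {n} (f : Label m n k) → IsCROrdered m n k f → ∃[ V ] f ≡ encode V × usesExactlyᵇ (below k) V ≡ true
  crOrdered⇒encode f cro = V , f≡V , usesExactlyᵇ-complete (below k) V (encode-nonempty⁻ V
    (IsColoredPartition.nonempty (IsCROrdered.partition (subst (IsCROrdered m _ k) f≡V cro))))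
    where
    decoded : ∃[ V ] f ≡ encode V
    decoded = decode f (IsColoredPartition.zeroBlock (IsCROrdered.partition cro)) (crOrdered-rotational f cro)
    V = proj₁ decoded
    f≡V = proj₂ decoded

module StandardForm (m k : ℕ) .{{_ : NonZero m}} where
  open ModArith m
  open Encoding m k
  open OrbitSets m k
  open Decoding m k
  open EncodedPartitions m k

  module _ {n} (f : Label m n k) (std : IsStandard m n k f) where
    open IsStandard std
    open IsColoredPartition partition

    -- In standard form the rotation t carrying S_(lm+1) to S_(lm+1+u) must be u: the least base s of
    -- the orbit has its colour-(j mod m) element in S_j for every block S_j of the orbit.
    standard-rotational : Rotational f
    standard-rotational l l<k u u<m with orbits l l<k u u<m
    ... | t , t<m , rot = subst (λ t′ → RotBlock m n k f t′ b (b + u)) (sym u≡t) rot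
      where
      b = l * m + 1
      b+v≤km : ∀ v → v < m → b + v ≤ k * m
      b+v≤km v v<m = subst (_≤ k * m) (trans (sym (+-suc (l * m) v)) (sym (+-assoc (l * m) 1 v))) (p*m+r<k*m l<k v<m)
      1≤b+v : ∀ v → 1 ≤ b + v
      1≤b+v v = subst (1 ≤_) (trans (sym (+-suc (l * m) v)) (sym (+-assoc (l * m) 1 v))) (s≤s z≤n)
      witness : ∃[ i ] ∃[ c ] lab m n k f i c ≡ b + 0
      witness = nonempty (b + 0) (1≤b+v 0) (b+v≤km 0 (>-nonZero⁻¹ m))
      least : ∃[ s ] toℕ s ≡ minb m n k f (b + 0)
      least = foldr-select _ toℕ n (allFin n) (∈-allFin (proj₁ witness))
                (any-true _ (allFin m) (∈-allFin (proj₁ (proj₂ witness)))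
                          (reflects-complete (≡ᵇ-reflects-≡ _ (b + 0)) (proj₂ (proj₂ witness))))
      s = proj₁ least
      s≡minb : ∀ v → v < m → toℕ s ≡ minb m n k f (b + v)
      s≡minb v v<m with orbits l l<k v v<m
      ... | t′ , _ , rot′ = trans (proj₂ least) (trans (cong (minb m n k f) (+-identityʳ b)) (minb-rotate f t′ b (b + v) rot′))
      colour : ℕ → Fin m
      colour v = fromℕ< (m%n<n (b + v) m)
      lab-colour : ∀ v → v < m → lab m n k f s (colour v) ≡ b + v
      lab-colour v v<m = colours (b + v) (1≤b+v v) (b+v≤km v v<m) s (colour v) (s≡minb v v<m) (Fin.toℕ-fromℕ< _)
      rotated : rotate t (colour 0) ≡ colour t
      rotated = Fin.toℕ-injective (begin
        toℕ (rotate t (colour 0))     ≡⟨ toℕ-rotate t (colour 0) ⟩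
        (toℕ (colour 0) + t) % m      ≡⟨ cong (λ z → (z + t) % m) (Fin.toℕ-fromℕ< _) ⟩
        ((b + 0) % m + t) % m         ≡⟨ [m%d+n]%d≡[m+n]%d (b + 0) t ⟩
        (b + 0 + t) % m               ≡⟨ cong (λ z → (z + t) % m) (+-identityʳ b) ⟩
        (b + t) % m                   ≡⟨ sym (Fin.toℕ-fromℕ< _) ⟩
        toℕ (colour t)                ∎)
        where open ≡-Reasoning
      u≡t : u ≡ t
      u≡t = +-cancelˡ-≡ b u t (begin
        b + u                         ≡⟨ sym (Equivalence.to (rot s (colour 0) (rotate t (colour 0)) (toℕ-rotate t (colour 0)))
                                                (trans (lab-colour 0 (>-nonZero⁻¹ m)) (+-identityʳ b))) ⟩
        lab m n k f s (rotate t (colour 0)) ≡⟨ cong (lab m n k f s) rotated ⟩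
        lab m n k f s (colour t)      ≡⟨ lab-colour t t<m ⟩
        b + t                         ∎)
        where open ≡-Reasoning

  OffsetLast : Code → Set
  OffsetLast nothing        = ⊥
  OffsetLast (just (_ , o)) = toℕ o ≡ m ∸ 1

  Increasing : ∀ {n} → ℕ → Codes n → Set
  Increasing j V = ∀ l → suc l < j → leader V l < leader V (suc l)

  LeadersAligned : ∀ {n} → ℕ → Codes n → Set
  LeadersAligned j V = ∀ p → p < j → OffsetLast (codeAt V (leader V p))

  record Standard {n} (j : ℕ) (V : Codes n) : Set where
    field
      exact      : UsesExactly V (below j)
      increasing : Increasing j V
      aligned    : LeadersAligned j V

  module _ {n} (V : Codes n) (x : Code) {j} (used : ∀ r → r < j → uses V r ≡ true) where

    leader-▹ : ∀ r → r < j → leader (V ▹ x) r ≡ leader V r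
    leader-▹ r r<j = leader-▹-used V x r (used r r<j)

    codeAt-leader-▹ : ∀ r → r < j → codeAt (V ▹ x) (leader (V ▹ x) r) ≡ codeAt V (leader V r)
    codeAt-leader-▹ r r<j = trans (cong (codeAt (V ▹ x)) (leader-▹ r r<j)) (codeAt-▹-< V x (leader<n V r (used r r<j)))

    Increasing-▹ : Increasing j (V ▹ x) ⇔ Increasing j V
    Increasing-▹ = mk⇔
      (λ inc l 1+l<j → subst₂ _<_ (leader-▹ l (<-trans (n<1+n l) 1+l<j)) (leader-▹ (suc l) 1+l<j) (inc l 1+l<j))
      (λ inc l 1+l<j → subst₂ _<_ (sym (leader-▹ l (<-trans (n<1+n l) 1+l<j))) (sym (leader-▹ (suc l) 1+l<j)) (inc l 1+l<j))

    LeadersAligned-▹ : LeadersAligned j (V ▹ x) ⇔ LeadersAligned j V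
    LeadersAligned-▹ = mk⇔
      (λ al p p<j → subst OffsetLast (codeAt-leader-▹ p p<j) (al p p<j))
      (λ al p p<j → subst OffsetLast (sym (codeAt-leader-▹ p p<j)) (al p p<j))

  Standard-▹ : ∀ {n} j (V : Codes n) x → standardᵇ j V ≡ true → Standard j V → standardᵇ j (V ▹ x) ≡ true →
               Standard j (V ▹ x)
  Standard-▹ j V x stdV st std▹ = record
    { exact      = standardᵇ-exact j (V ▹ x) std▹
    ; increasing = Equivalence.from (Increasing-▹ V x used) (Standard.increasing st)
    ; aligned    = Equivalence.from (LeadersAligned-▹ V x used) (Standard.aligned st)
    }
    where
    used : ∀ r → r < j → uses V r ≡ true
    used r r<j = trans (standardᵇ-uses j V stdV r) (reflects-complete (<ᵇ-reflects-< r j) r<j)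

  Standard-▹-opens : ∀ {n} (V : Codes n) p o → standardᵇ (toℕ p) V ≡ true → Standard (toℕ p) V → toℕ o ≡ m ∸ 1 →
                     Standard (suc (toℕ p)) (V ▹ just (p , o))
  Standard-▹-opens {n} V p o stdV st o≡ = record
    { exact      = λ r _ → trans (cong (_∨ (P ≡ᵇ r)) (standardᵇ-uses P V stdV r)) (<ᵇ-∨-≡ᵇ r P)
    ; increasing = increasing
    ; aligned    = aligned
    }
    where
    P = toℕ p
    x = just (p , o)
    used : ∀ r → r < P → uses V r ≡ true
    used r r<P = trans (standardᵇ-uses P V stdV r) (reflects-complete (<ᵇ-reflects-< r P) r<P)
    leader-new : leader (V ▹ x) P ≡ n
    leader-new rewrite trans (standardᵇ-uses P V stdV P) (reflects-false (<ᵇ-reflects-< P P) (<-irrefl refl)) | ≡ᵇ-refl P = refl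
    increasing : Increasing (suc P) (V ▹ x)
    increasing l 1+l<1+P with m<1+n⇒m<n∨m≡n 1+l<1+P
    ... | inj₁ 1+l<P = Equivalence.from (Increasing-▹ V x used) (Standard.increasing st) l 1+l<P
    ... | inj₂ 1+l≡P = subst₂ _<_ (sym (leader-▹ V x used l l<P)) (sym (trans (cong (leader (V ▹ x)) 1+l≡P) leader-new))
                                 (leader<n V l (used l l<P))
      where
      l<P : l < P
      l<P = subst (l <_) 1+l≡P (n<1+n l)
    aligned : LeadersAligned (suc P) (V ▹ x)
    aligned r r<1+P with m<1+n⇒m<n∨m≡n r<1+P
    ... | inj₁ r<P = Equivalence.from (LeadersAligned-▹ V x used) (Standard.aligned st) r r<P
    ... | inj₂ r≡P = subst OffsetLast (sym (trans (cong (λ z → codeAt (V ▹ x) (leader (V ▹ x) z)) r≡P)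
                                         (trans (cong (codeAt (V ▹ x)) leader-new) (codeAt-▹-last V x)))) o≡

  standardᵇ-sound : ∀ {n} j (V : Codes n) → standardᵇ j V ≡ true → Standard j V
  standardᵇ-sound j [] e rewrite reflects-sound (≡ᵇ-reflects-≡ j 0) e =
    record { exact = λ _ _ → refl ; increasing = λ _ () ; aligned = λ _ () }
  standardᵇ-sound j (V ▹ nothing) e = Standard-▹ j V nothing e (standardᵇ-sound j V e) e
  standardᵇ-sound j (V ▹ just (p , o)) e with ∨-true {(toℕ p <ᵇ j) ∧ standardᵇ j V} e
  ... | inj₁ joins = Standard-▹ j V (just (p , o)) stdV (standardᵇ-sound j V stdV) e
    where
    stdV : standardᵇ j V ≡ true
    stdV = proj₂ (∧-true {toℕ p <ᵇ j} joins)
  ... | inj₂ opens with ∧-true {suc (toℕ p) ≡ᵇ j} opens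
  ...   | j≡ , rest with ∧-true {toℕ o ≡ᵇ m ∸ 1} rest
  ...     | o≡ , stdP = subst (λ i → Standard i (V ▹ just (p , o))) (reflects-sound (≡ᵇ-reflects-≡ (suc (toℕ p)) j) j≡)
    (Standard-▹-opens V p o stdP (standardᵇ-sound (toℕ p) V stdP) (reflects-sound (≡ᵇ-reflects-≡ (toℕ o) (m ∸ 1)) o≡))

  Standard-▹⁻ : ∀ {n j} (V : Codes n) x → j ≤ k → UsesExactly V (below j) → Standard j (V ▹ x) → Standard j V
  Standard-▹⁻ {j = j} V x j≤k exactV st = record
    { exact      = exactV
    ; increasing = Equivalence.to (Increasing-▹ V x used) (Standard.increasing st)
    ; aligned    = Equivalence.to (LeadersAligned-▹ V x used) (Standard.aligned st)
    }
    where
    used : ∀ r → r < j → uses V r ≡ true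
    used r r<j = trans (exactV r (<-≤-trans r<j j≤k)) (reflects-complete (<ᵇ-reflects-< r j) r<j)

  below-suc-∖ : ∀ P r → (below (suc P) ∖ P) r ≡ below P r
  below-suc-∖ P r with P ≡ᵇ r in P≡ᵇr
  ... | true  rewrite sym (reflects-sound (≡ᵇ-reflects-≡ P r) P≡ᵇr) =
        trans (∧-zeroʳ (P <ᵇ suc P)) (sym (reflects-false (<ᵇ-reflects-< P P) (<-irrefl refl)))
  ... | false = trans (∧-identityʳ (r <ᵇ suc P)) (trans (sym (<ᵇ-∨-≡ᵇ r P)) (trans (cong ((r <ᵇ P) ∨_) P≡ᵇr) (∨-identityʳ _)))

  module _ {n j} (V : Codes n) p o (j≤k : j ≤ k) (st : Standard j (V ▹ just (p , o))) (fresh : uses V (toℕ p) ≡ false) where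
    private
      P = toℕ p
      x = just (p , o)
      exact = Standard.exact st
      leader-new : leader (V ▹ x) P ≡ n
      leader-new rewrite fresh | ≡ᵇ-refl P = refl

    opened<j : P < j
    opened<j = reflects-sound (<ᵇ-reflects-< P j) (UsesExactly-▹-orbit V p o (below j) exact)

    -- The opened orbit's leader is the new base n, larger than every earlier leader, so by
    -- increasingness no orbit can follow it.
    opened-last : j ≡ suc P
    opened-last = ≤-antisym (≮⇒≥ beyond-impossible) opened<j
      where
      beyond-impossible : ¬ (suc P < j)
      beyond-impossible 1+P<j = <-irrefl refl (begin-strict
        n                          ≡⟨ sym leader-new ⟩
        leader (V ▹ x) P           <⟨ Standard.increasing st P 1+P<j ⟩
        leader (V ▹ x) (suc P)     ≡⟨ leader-▹-used V x (suc P) used-1+P ⟩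
        leader V (suc P)           <⟨ leader<n V (suc P) used-1+P ⟩
        n                          ∎)
        where
        open ≤-Reasoning
        used-1+P : uses V (suc P) ≡ true
        used-1+P = trans (sym (∨-identityʳ _))
          (trans (cong (uses V (suc P) ∨_) (sym (reflects-false (≡ᵇ-reflects-≡ P (suc P)) (<⇒≢ (n<1+n P)))))
          (trans (exact (suc P) (<-≤-trans 1+P<j j≤k)) (reflects-complete (<ᵇ-reflects-< (suc P) j) 1+P<j)))

    opened-offset : toℕ o ≡ m ∸ 1
    opened-offset = subst OffsetLast (trans (cong (codeAt (V ▹ x)) leader-new) (codeAt-▹-last V x)) (Standard.aligned st P opened<j)

    Standard-▹-opens⁻ : Standard P V
    Standard-▹-opens⁻ = record
      { exact      = exactP
      ; increasing = Equivalence.to (Increasing-▹ V x usedP) (λ l 1+l<P → Standard.increasing st l (<-trans 1+l<P opened<j))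
      ; aligned    = Equivalence.to (LeadersAligned-▹ V x usedP) (λ r r<P → Standard.aligned st r (<-trans r<P opened<j))
      }
      where
      exactP : UsesExactly V (below P)
      exactP r r<k = trans (UsesExactly-▹-opens V p o (below j) exact fresh r r<k)
                           (trans (cong (λ i → (below i ∖ P) r) opened-last) (below-suc-∖ P r))
      usedP : ∀ r → r < P → uses V r ≡ true
      usedP r r<P = trans (exactP r (<-≤-trans r<P (≤-trans (<⇒≤ opened<j) j≤k))) (reflects-complete (<ᵇ-reflects-< r P) r<P)

  standardᵇ-complete : ∀ {n} j (V : Codes n) → j ≤ k → Standard j V → standardᵇ j V ≡ true
  standardᵇ-complete zero    [] _   _  = refl
  standardᵇ-complete (suc j) [] 1+j≤k st = clash refl (sym (Standard.exact st 0 (<-≤-trans z<s 1+j≤k)))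
  standardᵇ-complete j (V ▹ nothing) j≤k st = standardᵇ-complete j V j≤k
    (Standard-▹⁻ V nothing j≤k (λ r r<k → trans (sym (∨-identityʳ _)) (Standard.exact st r r<k)) st)
  standardᵇ-complete j (V ▹ just (p , o)) j≤k st with uses V (toℕ p) in u
  ... | true  = cong₂ (λ a b → (a ∧ b) ∨ ((suc (toℕ p) ≡ᵇ j) ∧ (toℕ o ≡ᵇ m ∸ 1) ∧ standardᵇ (toℕ p) V))
                      (UsesExactly-▹-orbit V p o (below j) (Standard.exact st))
                      (standardᵇ-complete j V j≤k (Standard-▹⁻ V (just (p , o)) j≤k
                        (UsesExactly-▹-joins V p o (below j) (Standard.exact st) u) st))
  ... | false = trans (cong (((toℕ p <ᵇ j) ∧ standardᵇ j V) ∨_) (cong₂ _∧_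
                  (reflects-complete (≡ᵇ-reflects-≡ (suc (toℕ p)) j) (sym (opened-last V p o j≤k st u)))
                  (cong₂ _∧_ (reflects-complete (≡ᵇ-reflects-≡ (toℕ o) (m ∸ 1)) (opened-offset V p o j≤k st u))
                             (standardᵇ-complete (toℕ p) V (≤-trans (<⇒≤ (opened<j V p o j≤k st u)) j≤k)
                                                 (Standard-▹-opens⁻ V p o j≤k st u)))))
                (∨-zeroʳ _)

  minb-encode-orbitEnd : ∀ {n} (V : Codes n) l → minb m n k (encode V) (suc l * m) ≡ leader V l
  minb-encode-orbitEnd V l = begin
    minb m _ k (encode V) (suc l * m)                  ≡⟨ cong (minb m _ k (encode V)) orbitEnd ⟩
    minb m _ k (encode V) (suc (l * m + (m ∸ 1)))      ≡⟨ minb-encode V (l * m + (m ∸ 1)) ⟩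
    leader V ((l * m + (m ∸ 1)) / m)                    ≡⟨ cong (leader V) ([p*d+r]/d≡p l (subst (m ∸ 1 <_) suc[d∸1]≡d ≤-refl)) ⟩
    leader V l                                          ∎
    where
    open ≡-Reasoning
    orbitEnd : suc l * m ≡ suc (l * m + (m ∸ 1))
    orbitEnd = trans (+-comm m (l * m)) (trans (cong (l * m +_) (sym suc[d∸1]≡d)) (+-suc (l * m) (m ∸ 1)))

  encode-standard : ∀ {n} (V : Codes n) → Standard k V → IsStandard m n k (encode V)
  encode-standard {n} V st = record
    { partition  = encode-partition V (Standard.exact st)
    ; increasing = increasing
    ; colours    = colours
    }
    where
    increasing : ∀ l → 1 ≤ l → l < k → minb m n k (encode V) (l * m) < minb m n k (encode V) (suc l * m)
    increasing (suc l) _ 1+l<k = subst₂ _<_ (sym (minb-encode-orbitEnd V l)) (sym (minb-encode-orbitEnd V (suc l)))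
                                           (Standard.increasing st l 1+l<k)
    colours : ∀ j → 1 ≤ j → j ≤ k * m → ∀ i c → toℕ i ≡ minb m n k (encode V) j → toℕ c ≡ j % m →
              lab m n k (encode V) i c ≡ j
    colours (suc j) _ j<km i c i≡ c≡ = trans (lab-encode V i c)
      (trans (cong (λ i′ → block (codeAt V i′) (toℕ c)) (trans i≡ (minb-encode V j)))
             (leaderBlock (codeAt V (leader V r)) (leader-inOrbit V r used) (Standard.aligned st r r<k)))
      where
      r = j / m
      r<k : r < k
      r<k = m<n*o⇒m/o<n j<km
      used : uses V r ≡ true
      used = trans (Standard.exact st r r<k) (reflects-complete (<ᵇ-reflects-< r k) r<k)
      leaderBlock : ∀ x → inOrbit x r ≡ true → OffsetLast x → block x (toℕ c) ≡ suc j
      leaderBlock (just (p , o)) p≡ᵇr o≡ = cong suc (begin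
        toℕ p * m + (toℕ o + toℕ c) % m
          ≡⟨ cong₂ (λ a b → a * m + (b + toℕ c) % m) (reflects-sound (≡ᵇ-reflects-≡ (toℕ p) r) p≡ᵇr) o≡ ⟩
        r * m + (m ∸ 1 + toℕ c) % m              ≡⟨ cong (λ z → r * m + (m ∸ 1 + z) % m) c≡ ⟩
        r * m + (m ∸ 1 + suc j % m) % m          ≡⟨ cong (r * m +_) ([d∸1+[1+m]%d]%d≡m%d j) ⟩
        r * m + j % m                            ≡⟨ sym (m≡[m/d]*d+m%d j) ⟩
        j                                        ∎)
        where open ≡-Reasoning

  encode-standard⁻ : ∀ {n} (V : Codes n) → IsStandard m n k (encode V) → Standard k V
  encode-standard⁻ {n} V std = record { exact = exact ; increasing = increasing ; aligned = aligned }
    where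
    exact : UsesExactly V (below k)
    exact = encode-nonempty⁻ V (IsColoredPartition.nonempty (IsStandard.partition std))
    increasing : Increasing k V
    increasing l 1+l<k = subst₂ _<_ (minb-encode-orbitEnd V l) (minb-encode-orbitEnd V (suc l))
                                    (IsStandard.increasing std (suc l) (s≤s z≤n) 1+l<k)
    aligned : LeadersAligned k V
    aligned p p<k = offsetLast (codeAt V (leader V p)) (begin
      block (codeAt V (leader V p)) (toℕ c)       ≡⟨ cong (λ i′ → block (codeAt V i′) (toℕ c)) (sym (Fin.toℕ-fromℕ< _)) ⟩
      block (codeAt V (toℕ i)) (toℕ c)            ≡⟨ sym (lab-encode V i c) ⟩
      lab m n k (encode V) i c
        ≡⟨ IsStandard.colours std (suc (p * m)) (s≤s z≤n) firstBlock≤ i c i≡ (Fin.toℕ-fromℕ< _) ⟩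
      suc (p * m)                                 ∎)
      where
      open ≡-Reasoning
      used = trans (exact p p<k) (reflects-complete (<ᵇ-reflects-< p k) p<k)
      i = fromℕ< (leader<n V p used)
      c = fromℕ< (m%n<n (suc (p * m)) m)
      firstBlock≤ : suc (p * m) ≤ k * m
      firstBlock≤ = subst (_< k * m) (+-identityʳ (p * m)) (p*m+r<k*m p<k (>-nonZero⁻¹ m))
      i≡ : toℕ i ≡ minb m n k (encode V) (suc (p * m))
      i≡ = trans (Fin.toℕ-fromℕ< _) (sym (trans (minb-encode V (p * m)) (cong (leader V) (m*n/n≡m p m))))
      offsetLast : ∀ x → block x (toℕ c) ≡ suc (p * m) → OffsetLast x
      offsetLast (just (p′ , o)) eq = [m+1]%d≡0⇒m≡d∸1 (Fin.toℕ<n o) (begin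
        (toℕ o + 1) % m                    ≡⟨ sym ([m+kn]%n≡m%n (toℕ o + 1) p m) ⟩
        (toℕ o + 1 + p * m) % m            ≡⟨ cong (_% m) (+-assoc (toℕ o) 1 (p * m)) ⟩
        (toℕ o + suc (p * m)) % m          ≡⟨ sym ([m+n%d]%d≡[m+n]%d (toℕ o) (suc (p * m))) ⟩
        (toℕ o + suc (p * m) % m) % m      ≡⟨ cong (λ z → (toℕ o + z) % m) (sym (Fin.toℕ-fromℕ< _)) ⟩
        (toℕ o + toℕ c) % m                ≡⟨ proj₂ (divMod-unique (toℕ p′) p (m%n<n (toℕ o + toℕ c) m) (>-nonZero⁻¹ m)
                                                (trans (suc-injective eq) (sym (+-identityʳ (p * m))))) ⟩
        0                                  ∎)

  standard⇒encode : ∀ {n} (f : Label m n k) → IsStandard m n k f → ∃[ V ] f ≡ encode V × standardᵇ k V ≡ true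
  standard⇒encode f std = V , f≡V , standardᵇ-complete k V ≤-refl (encode-standard⁻ V (subst (IsStandard m _ k) f≡V std))
    where
    decoded : ∃[ V ] f ≡ encode V
    decoded = decode f (IsColoredPartition.zeroBlock (IsStandard.partition std)) (standard-rotational f std)
    V = proj₁ decoded
    f≡V = proj₂ decoded

module Enumeration (m k : ℕ) .{{_ : NonZero m}} where
  open Encoding m k

  alphabet-unique : Unique alphabet
  alphabet-unique = allJust _ ∷ Unique.map⁺ (λ { refl → refl }) (Unique.cartesianProduct⁺ (Unique.allFin⁺ k) (Unique.allFin⁺ m))
    where
    allJust : ∀ (ys : List (Fin k × Fin m)) → All (λ y → ¬ (nothing ≡ y)) (map just ys)
    allJust []       = []
    allJust (y ∷ ys) = (λ ()) ∷ allJust ys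

  ∈-alphabet : ∀ x → x ∈ alphabet
  ∈-alphabet nothing        = here refl
  ∈-alphabet (just (p , o)) = there (∈-map⁺ just (∈-cartesianProduct⁺ (∈-allFin p) (∈-allFin o)))

  ▹-injective : ∀ {n} {V V′ : Codes n} {x x′} → V ▹ x ≡ V′ ▹ x′ → V ≡ V′ × x ≡ x′
  ▹-injective refl = refl , refl

  allCodes-unique : ∀ n → Unique (allCodes n)
  allCodes-unique zero    = [] ∷ []
  allCodes-unique (suc n) = Unique.cartesianProductWith⁺ _▹_ ▹-injective (allCodes-unique n) alphabet-unique

  ∈-allCodes : ∀ {n} (V : Codes n) → V ∈ allCodes n
  ∈-allCodes []      = here refl
  ∈-allCodes (V ▹ x) = ∈-cartesianProductWith⁺ _▹_ (∈-allCodes V) (∈-alphabet x)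

  Codes-ext : ∀ {n} (V V′ : Codes n) → (∀ i → i < n → codeAt V i ≡ codeAt V′ i) → V ≡ V′
  Codes-ext []      []        _  = refl
  Codes-ext (V ▹ x) (V′ ▹ x′) eq = cong₂ _▹_
    (Codes-ext V V′ (λ i i<n → trans (sym (codeAt-▹-< V x i<n)) (trans (eq i (m<n⇒m<1+n i<n)) (codeAt-▹-< V′ x′ i<n))))
    (trans (sym (codeAt-▹-last V x)) (trans (eq _ ≤-refl) (codeAt-▹-last V′ x′)))

  encode-injective : ∀ {n} {V V′ : Codes n} → encode V ≡ encode V′ → V ≡ V′
  encode-injective {n} {V} {V′} eq = Codes-ext V V′ λ i i<n → block₀-injective _ _ (begin
    block (codeAt V i) 0                             ≡⟨ sym (blockAt V i<n) ⟩
    lab m n k (encode V) (fromℕ< i<n) colour₀       ≡⟨ cong (λ f → lab m n k f (fromℕ< i<n) colour₀) eq ⟩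
    lab m n k (encode V′) (fromℕ< i<n) colour₀      ≡⟨ blockAt V′ i<n ⟩
    block (codeAt V′ i) 0                            ∎)
    where
    open ≡-Reasoning
    blockAt : ∀ W {i} (i<n : i < n) → lab m n k (encode W) (fromℕ< i<n) colour₀ ≡ block (codeAt W i) 0
    blockAt W i<n = trans (lab-encode W _ colour₀) (cong₂ (λ i c → block (codeAt W i) c) (Fin.toℕ-fromℕ< i<n) (Fin.toℕ-fromℕ< _))

  module _ (q : ℕ) {n} (P : Codes n → Bool) (Q : Label m n k → Set)
           (encode-Q : ∀ V → P V ≡ true → Q (encode V))
           (Q-encode : ∀ f → Q f → ∃[ V ] f ≡ encode V × P V ≡ true) where
    open WeightedSums m k q

    -- Any duplicate-free list of exactly the labellings satisfying Q is a permutation of the encodings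
    -- of the code words satisfying P.
    genfun-codes : (L : List (Label m n k)) → Unique L → (∀ f → (f ∈ L) ⇔ Q f) →
                   genfun m n k q L ≡ ∑Codes n (λ V → ind (P V) * weight V)
    genfun-codes L unique members = begin
      genfun m n k q L                                                ≡⟨ sum-↭ (Perm.map⁺ (λ f → q ^ inv m n k f) L↭E) ⟩
      sum (map (λ f → q ^ inv m n k f) E)                             ≡⟨ cong sum (sym (map-∘ selected)) ⟩
      sum (map (λ V → q ^ inv m n k (encode V)) selected)             ≡⟨ sum-map-filter (allCodes n) ⟩
      ∑Codes n (λ V → ind (P V) * q ^ inv m n k (encode V))
        ≡⟨ cong sum (map-cong (λ V → cong (λ z → ind (P V) * q ^ z) (inv-encode V)) (allCodes n)) ⟩
      ∑Codes n (λ V → ind (P V) * weight V)                           ∎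
      where
      open ≡-Reasoning
      selected = filter (λ V → T? (P V)) (allCodes n)
      E = map encode selected
      E-unique : Unique E
      E-unique = Unique.map⁺ encode-injective (Unique.filter⁺ (λ V → T? (P V)) (allCodes-unique n))
      ∈L⇔∈E : ∀ {f} → f ∈ L ⇔ f ∈ E
      ∈L⇔∈E {f} = mk⇔ ∈L⇒∈E ∈E⇒∈L
        where
        ∈L⇒∈E : f ∈ L → f ∈ E
        ∈L⇒∈E f∈L with Q-encode f (Equivalence.to (members f) f∈L)
        ... | V , refl , PV = ∈-map⁺ encode (∈-filter⁺ (λ V → T? (P V)) (∈-allCodes V) (Equivalence.from T-≡ PV))
        ∈E⇒∈L : f ∈ E → f ∈ L
        ∈E⇒∈L f∈E with ∈-map⁻ encode f∈E
        ... | V , V∈ , refl = Equivalence.from (members (encode V))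
                                (encode-Q V (Equivalence.to T-≡ (proj₂ (∈-filter⁻ (λ V → T? (P V)) {xs = allCodes n} V∈))))
      L↭E : L ↭ E
      L↭E = ∼bag⇒↭ (unique∧set⇒bag unique E-unique ∈L⇔∈E)
      sum-map-filter : ∀ (Vs : List (Codes n)) → sum (map (λ V → q ^ inv m n k (encode V)) (filter (λ V → T? (P V)) Vs))
                       ≡ sum (map (λ V → ind (P V) * q ^ inv m n k (encode V)) Vs)
      sum-map-filter []       = refl
      sum-map-filter (V ∷ Vs) with P V
      ... | true  = cong₂ _+_ (sym (+-identityʳ _)) (sum-map-filter Vs)
      ... | false = sum-map-filter Vs

  module _ (q : ℕ) {n : ℕ} where
    open OrbitSets m k
    open WeightedSums m k q
    open EncodedPartitions m k
    open StandardForm m k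

    genfun-standard : (L : List (Label m n k)) → Unique L → (∀ f → (f ∈ L) ⇔ IsStandard m n k f) →
                      genfun m n k q L ≡ stdSum k n
    genfun-standard = genfun-codes q (standardᵇ k) (IsStandard m n k)
      (λ V std → encode-standard V (standardᵇ-sound k V std)) standard⇒encode

    genfun-crOrdered : (L : List (Label m n k)) → Unique L → (∀ f → (f ∈ L) ⇔ IsCROrdered m n k f) →
                       genfun m n k q L ≡ crSum (below k) n
    genfun-crOrdered = genfun-codes q (usesExactlyᵇ (below k)) (IsCROrdered m n k)
      (λ V exact → encode-crOrdered V (usesExactlyᵇ-sound (below k) V exact)) crOrdered⇒encode

theorem4p9 : (m n k : ℕ) → .{{_ : NonZero m}} →
    (Lstd : List (Label m n k)) → Unique Lstd → (∀ f → (f ∈ Lstd) ⇔ IsStandard m n k f) →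
    (Lcr : List (Label m n k)) → Unique Lcr → (∀ f → (f ∈ Lcr) ⇔ IsCROrdered m n k f) →
    (q : ℕ) → qfactm q m k * genfun m n k q Lstd ≡ genfun m n k q Lcr
theorem4p9 m n k Lstd uniqueStd membersStd Lcr uniqueCR membersCR q = begin
  qfactm q m k * genfun m n k q Lstd
    ≡⟨ cong (qfactm q m k *_) (genfun-standard q Lstd uniqueStd membersStd) ⟩
  qfactm q m k * stdSum k n
    ≡⟨ cong (qfactm q m k *_) (stdSum-closed n k ≤-refl) ⟩
  qfactm q m k * stirling n k
    ≡⟨ cong (λ s → qfactm q m s * stirling n s) (sym (size-below ≤-refl)) ⟩
  qfactm q m (size (below k)) * stirling n (size (below k))
    ≡⟨ sym (crSum-closed n (below k)) ⟩
  crSum (below k) n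
    ≡⟨ sym (genfun-crOrdered q Lcr uniqueCR membersCR) ⟩
  genfun m n k q Lcr
    ∎
  where
  open ≡-Reasoning
  open OrbitSets m k
  open WeightedSums m k q
  open Enumeration m k
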